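{- Let $\mu=(\mu_1,\dots,\mu_k)\vdash n$ and $a=(a_1,\dots,a_h)\vDash n$ with $\mu\unrhd\lambda(a)$, let $r\in R(\mu,a)$ with $r\le s(\mu,a)$, and define $a^i,l_i,\mu^i$ inductively by $a^0=a$, $l_0=r$, $\mu^0=\mu$ and, for $0\le i<n$, $a^{i+1}=\widetilde{a^i}$, $l_{i+1}=l(\mu^i,a^i,1)$ if $i\in A$ and $l_{i+1}=l(\mu^i,a^i,l_i)$ otherwise, $\mu^{i+1}=(\mu^i)^{(l_{i+1})}$, where $A=\{a_h,\ a_h+a_{h-1},\ \dots,\ a_h+\cdots+a_2\}$ (these are well defined under the hypotheses). Let $T\in\mathrm{STab}(\mu,a)$ and suppose $T^{ -1}(h)=\{(t_1,t_1'),(t_2,t_2'),\dots,(t_{a_h},t'_{a_h})\}$ with $r\le t_1\le t_2\le\cdots\le t_{a_h}$. Then $l_i\le t_i$ for $1\le i\le a_h$. In particular, $\mu^{(t_1,\dots,t_{a_h})}\unrhd\mu^{a_h}$.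
   Context: A composition $a\vDash n$ is a sequence of positive integers summing to $n$; a partition $\mu\vdash n$ is a non-increasing composition, with $\mu_i=0$ beyond its parts and trailing zeros deleted. For compositions $a=(a_1,\dots,a_h)$, $b=(b_1,\dots,b_k)$ of $n$, $a\unrhd b$ means $k\ge h$ and $\sum_{i=1}^j a_i\ge\sum_{i=1}^jb_i$ for $j=1,\dots,h$. $\lambda(a)$ is the non-increasing rearrangement of $a$; $\tilde a=(a_1,\dots,a_{h-1},a_h-1)$ if $a_h\ge2$ and $\tilde a=(a_1,\dots,a_{h-1})$ if $a_h=1$. $\mu^{(i)}$ is $\mu$ with its $i$-th entry decreased by $1$, and $\mu^{(i_1,\dots,i_j)}=(\cdots(\mu^{(i_1)})^{(i_2)}\cdots)^{(i_j)}$. $D_\mu=\{(i,j):1\le i\le k,1\le j\le\mu_i\}$; $\mathrm{STab}(\mu,a)$ is the set of maps $T:D_\mu\to\{1,\dots,h\}$ with $T(i,j)\le T(i,j+1)$, $T(i,j)<T(i+1,j)$ and $|T^{ -1}(\{i\})|=a_i$ for all $i$. For a partition $\nu=(\nu_1,\dots,\nu_m)$ and composition $b$ of the same integer with last part $b_{h(b)}$: $s(\nu,b)=\max\{i:\nu_i\ge b_{h(b)}\}$; $R(\nu,b)$ is the set of $i\in\{1,\dots,m\}$ with $\nu_i>\nu_{i+1}$ and $\nu^{(i)}\unrhd\lambda(\tilde b)$; $R(\nu,b,i)=\{r\in R(\nu,b):r\ge i\}$ and $l(\nu,b,i)=\min R(\nu,b,i)$. -}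

module Defs where

open import Data.Nat using (ℕ; zero; suc; _+_; _∸_; _≤_; _<_; _≥_; _≤?_; _<?_; _⊔_; _≤ᵇ_)
open import Data.Nat.Properties using (≤-decTotalOrder)
open import Data.Bool using (Bool; true; false; if_then_else_)
open import Data.Fin using (Fin; toℕ)
open import Data.Fin.Properties using (all?)
open import Data.Nat.ListAction using (sum)
open import Data.List using (List; []; _∷_; length; take; reverse; map; upTo; foldl; concatMap; filter)
open import Data.List.Relation.Unary.All using (All)
open import Data.List.Relation.Unary.Linked using (Linked)
open import Data.List.Membership.DecPropositional Data.Nat._≟_ using (_∈?_)
open import Data.List.Membership.Propositional using (_∈_)
open import Data.Maybe using (Maybe; just; nothing; _>>=_)
open import Data.Product using (_×_; _,_; Σ)
open import Relation.Nullary using (Dec; yes; no; ¬_)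
open import Relation.Nullary.Decidable using (_×-dec_; ⌊_⌋)
open import Relation.Binary.PropositionalEquality using (_≡_)

-- Lists of naturals represent compositions / partitions.
-- at x i  =  x_i  (1-indexed), with x_i = 0 beyond the parts (and x_0 = 0, unused).
at : List ℕ → ℕ → ℕ
at []       _             = 0
at (x ∷ xs) zero          = 0
at (x ∷ xs) (suc zero)    = x
at (x ∷ xs) (suc (suc i)) = at xs (suc i)

IsComposition : ℕ → List ℕ → Set
IsComposition n a = All (λ x → 1 ≤ x) a × sum a ≡ n

IsPartition : ℕ → List ℕ → Set
IsPartition n μ = IsComposition n μ × Linked _≥_ μ

psum : List ℕ → ℕ → ℕ
psum x j = sum (take j x)

Dom : List ℕ → List ℕ → Set
Dom a b = length a ≤ length b
        × ((j : Fin (length a)) → psum b (suc (toℕ j)) ≤ psum a (suc (toℕ j)))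

dom? : (a b : List ℕ) → Dec (Dom a b)
dom? a b = (length a ≤? length b)
         ×-dec all? (λ j → psum b (suc (toℕ j)) ≤? psum a (suc (toℕ j)))

insertDesc : ℕ → List ℕ → List ℕ
insertDesc x []       = x ∷ []
insertDesc x (y ∷ ys) = if y ≤ᵇ x then x ∷ y ∷ ys else y ∷ insertDesc x ys

lam : List ℕ → List ℕ
lam []       = []
lam (x ∷ xs) = insertDesc x (lam xs)

tilde : List ℕ → List ℕ
tilde []                    = []
tilde (zero ∷ [])           = []
tilde (suc zero ∷ [])       = []
tilde (suc (suc x) ∷ [])    = suc x ∷ []
tilde (x ∷ y ∷ ys)          = x ∷ tilde (y ∷ ys)

lastPart : List ℕ → ℕ
lastPart []           = 0
lastPart (x ∷ [])     = x
lastPart (x ∷ y ∷ ys) = lastPart (y ∷ ys)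

stripZeros : List ℕ → List ℕ
stripZeros []       = []
stripZeros (x ∷ xs) with stripZeros xs
... | [] = if x ≤ᵇ 0 then [] else x ∷ []
... | y ∷ ys = x ∷ y ∷ ys

decAt′ : List ℕ → ℕ → List ℕ
decAt′ []       _             = []
decAt′ (x ∷ xs) zero          = x ∷ xs
decAt′ (x ∷ xs) (suc zero)    = (x ∸ 1) ∷ xs
decAt′ (x ∷ xs) (suc (suc i)) = x ∷ decAt′ xs (suc i)

decAt : List ℕ → ℕ → List ℕ
decAt μ i = stripZeros (decAt′ μ i)

decAll : List ℕ → List ℕ → List ℕ
decAll μ is = foldl decAt μ is

-- s(ν,b) = max{ i : ν_i ≥ b_{h(b)} }  (0 if the set is empty), computed over i = 1..m
smax′ : ℕ → List ℕ → ℕ → ℕ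
smax′ c []       i = 0
smax′ c (x ∷ xs) i = (if c ≤ᵇ x then i else 0) ⊔ smax′ c xs (suc i)

s : List ℕ → List ℕ → ℕ
s ν b = smax′ (lastPart b) ν 1

InR : List ℕ → List ℕ → ℕ → Set
InR ν b i = 1 ≤ i × i ≤ length ν × at ν (suc i) < at ν i × Dom (decAt ν i) (lam (tilde b))

inR? : (ν b : List ℕ) (i : ℕ) → Dec (InR ν b i)
inR? ν b i = (1 ≤? i) ×-dec (i ≤? length ν) ×-dec (at ν (suc i) <? at ν i)
           ×-dec dom? (decAt ν i) (lam (tilde b))

firstSat : {P : ℕ → Set} → ((x : ℕ) → Dec (P x)) → List ℕ → Maybe ℕ
firstSat P? []       = nothing
firstSat P? (x ∷ xs) with P? x
... | yes _ = just x
... | no  _ = firstSat P? xs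

-- l(ν,b,i) = min R(ν,b,i) = min { r ∈ R(ν,b) : r ≥ i }; nothing if this set is empty.
-- Computed as the first element of 1,2,...,m lying in R(ν,b,i).
lmin : List ℕ → List ℕ → ℕ → Maybe ℕ
lmin ν b i = firstSat (λ r → (i ≤? r) ×-dec inR? ν b r) (map suc (upTo (length ν)))

Aset : List ℕ → List ℕ
Aset a = map (λ j → sum (take j (reverse a))) (map suc (upTo (length a ∸ 1)))

-- seqAlμ a μ r i = (a^i , l_i , μ^i), or nothing if some l_j (j ≤ i) is undefined.
-- a^0 = a, l_0 = r, μ^0 = μ;
-- a^{i+1} = ~(a^i), l_{i+1} = l(μ^i,a^i,1) if i ∈ A, else l(μ^i,a^i,l_i), μ^{i+1} = (μ^i)^{(l_{i+1})}.
seqAlμ : List ℕ → List ℕ → ℕ → ℕ → Maybe (List ℕ × ℕ × List ℕ)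
seqAlμ a μ r zero    = just (a , r , μ)
seqAlμ a μ r (suc i) = seqAlμ a μ r i >>= λ where
  (ai , li , μi) → lmin μi ai (if ⌊ i ∈? Aset a ⌋ then 1 else li) >>= λ l′ →
                   just (tilde ai , l′ , decAt μi l′)

lSeq : List ℕ → List ℕ → ℕ → ℕ → Maybe ℕ
lSeq a μ r i = seqAlμ a μ r i >>= λ where (_ , l , _) → just l

μSeq : List ℕ → List ℕ → ℕ → ℕ → Maybe (List ℕ)
μSeq a μ r i = seqAlμ a μ r i >>= λ where (_ , _ , ν) → just ν

InD : List ℕ → ℕ → ℕ → Set
InD μ i j = 1 ≤ i × i ≤ length μ × 1 ≤ j × j ≤ at μ i

cells : List ℕ → List (ℕ × ℕ)
cells μ = concatMap (λ i → map (λ j → (suc i , suc j)) (upTo (at μ (suc i)))) (upTo (length μ))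

fiberSize : (ℕ → ℕ → ℕ) → List ℕ → ℕ → ℕ
fiberSize T μ x = length (filter (λ c → Data.Nat._≟_ (T (Data.Product.proj₁ c) (Data.Product.proj₂ c)) x) (cells μ))

-- T ∈ STab(μ,a) : T : D_μ → {1..h} (values of T off D_μ are irrelevant)
IsSTab : List ℕ → List ℕ → (ℕ → ℕ → ℕ) → Set
IsSTab μ a T =
    (∀ i j → InD μ i j → 1 ≤ T i j × T i j ≤ length a)
  × (∀ i j → InD μ i j → InD μ i (suc j) → T i j ≤ T i (suc j))
  × (∀ i j → InD μ i j → InD μ (suc i) j → T i j < T (suc i) j)
  × (∀ x → 1 ≤ x → x ≤ length a → fiberSize T μ x ≡ at a x)

module Submission where

-- Follow the construction, maintaining that μ^i is μ with one cell removed from each of the rows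
-- l_1, …, l_i, that l_k ≤ t_k, and that μ^i ⊵ λ(a^i). For the step it suffices that t_{i+1} ∈ R(μ^i, a^i):
-- then l_{i+1} = min R(μ^i, a^i, l_i) ≤ t_{i+1}, as i < a_h means i ∉ A and l_i ≤ t_i ≤ t_{i+1}.
-- Row t_{i+1} of μ^i ends in a corner, because it still holds its cell of value h, which by column
-- strictness lies beyond the end of row t_{i+1}+1. Removing that corner keeps dominance: for
-- j ≥ t_{i+1}, column strictness lets the cells of the values carrying the j largest parts of a^{i+1}
-- be counted inside the first j rows of μ, alongside the i+1 cells of value h that lie there.

open import Defs
open import Data.Nat
open import Data.Nat.Properties
open import Data.Nat.ListAction using (sum)
open import Data.Nat.ListAction.Properties using (sum-++)
open import Data.Nat.Tactic.RingSolver using (solve-∀)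
open import Data.Bool using (Bool; true; false; T; _∧_)
open import Data.Bool.Properties using (∧-identityʳ; ∧-zeroʳ)
open import Data.Unit using (⊤; tt)
open import Data.Empty using (⊥; ⊥-elim)
open import Data.Product using (_×_; _,_; Σ; proj₁; proj₂)
open import Data.Sum using (_⊎_; inj₁; inj₂)
open import Data.Fin using (toℕ; fromℕ<)
open import Data.Fin.Properties using (toℕ-fromℕ<)
open import Data.Maybe using (just)
open import Data.List using (List; []; _∷_; length; take; map; _++_; _∷ʳ_; upTo; applyUpTo; reverse; filter; concatMap)
open import Data.List.Properties
  using (map-applyUpTo; unfold-reverse; length-map; length-++; length-take; take-all; map-++; map-∘)
open import Data.List.Relation.Unary.Any using (here; there)
open import Data.List.Relation.Unary.All as All using (All; []; _∷_)
open import Data.List.Relation.Unary.All.Properties using (∷ʳ⁺)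
open import Data.List.Relation.Unary.Linked using (Linked; []; [-]; _∷_)
open import Data.List.Relation.Binary.Pointwise as Pointwise using (Pointwise; []; _∷_)
open import Data.List.Membership.Propositional using (_∈_)
open import Data.List.Membership.Propositional.Properties using (∈-map⁻)
open import Data.List.Membership.DecPropositional Data.Nat._≟_ using (_∈?_)
open import Function using (id)
open import Function.Bundles using (_⇔_; Equivalence)
open import Relation.Nullary using (Dec; yes; no; does)
open import Relation.Nullary.Decidable using (⌊_⌋; _×-dec_)
open import Relation.Unary using (Decidable)
open import Relation.Binary.PropositionalEquality

𝟙 : Bool → ℕ
𝟙 true  = 1
𝟙 false = 0

𝟙≤1 : ∀ b → 𝟙 b ≤ 1
𝟙≤1 true  = s≤s z≤n
𝟙≤1 false = z≤n

≡ᵇ≡true⇒≡ : ∀ {m n} → (m ≡ᵇ n) ≡ true → m ≡ n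
≡ᵇ≡true⇒≡ {m} {n} e = ≡ᵇ⇒≡ m n (subst T (sym e) tt)

≡ᵇ≡false⇒≢ : ∀ {m n} → (m ≡ᵇ n) ≡ false → m ≢ n
≡ᵇ≡false⇒≢ {m} {n} e m≡n = subst T e (≡⇒≡ᵇ m n m≡n)

≡ᵇ-refl : ∀ m → (m ≡ᵇ m) ≡ true
≡ᵇ-refl zero    = refl
≡ᵇ-refl (suc m) = ≡ᵇ-refl m

≢⇒≡ᵇ≡false : ∀ {m n} → m ≢ n → (m ≡ᵇ n) ≡ false
≢⇒≡ᵇ≡false {m} {n} m≢n with m ≡ᵇ n in e
... | true  = ⊥-elim (m≢n (≡ᵇ≡true⇒≡ e))
... | false = refl

≤ᵇ≡true⇒≤ : ∀ {m n} → (m ≤ᵇ n) ≡ true → m ≤ n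
≤ᵇ≡true⇒≤ {m} {n} e = ≤ᵇ⇒≤ m n (subst T (sym e) tt)

≤ᵇ≡false⇒> : ∀ {m n} → (m ≤ᵇ n) ≡ false → n < m
≤ᵇ≡false⇒> e = ≰⇒> λ m≤n → subst T e (≤⇒≤ᵇ m≤n)

≤⇒≤ᵇ≡true : ∀ {m n} → m ≤ n → (m ≤ᵇ n) ≡ true
≤⇒≤ᵇ≡true {m} {n} m≤n with m ≤ᵇ n in e
... | true  = refl
... | false = ⊥-elim (<⇒≱ (≤ᵇ≡false⇒> e) m≤n)

>⇒≤ᵇ≡false : ∀ {m n} → n < m → (m ≤ᵇ n) ≡ false
>⇒≤ᵇ≡false {m} {n} n<m with m ≤ᵇ n in e
... | true  = ⊥-elim (<⇒≱ n<m (≤ᵇ≡true⇒≤ e))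
... | false = refl

∑ : ℕ → (ℕ → ℕ) → ℕ
∑ zero    f = 0
∑ (suc k) f = ∑ k f + f (suc k)

∑-cong : ∀ k {f g : ℕ → ℕ} → (∀ v → 1 ≤ v → v ≤ k → f v ≡ g v) → ∑ k f ≡ ∑ k g
∑-cong zero    e = refl
∑-cong (suc k) e = cong₂ _+_ (∑-cong k (λ v p q → e v p (m≤n⇒m≤1+n q))) (e (suc k) (s≤s z≤n) ≤-refl)

∑-mono : ∀ k {f g : ℕ → ℕ} → (∀ v → 1 ≤ v → v ≤ k → f v ≤ g v) → ∑ k f ≤ ∑ k g
∑-mono zero    e = z≤n
∑-mono (suc k) e = +-mono-≤ (∑-mono k (λ v p q → e v p (m≤n⇒m≤1+n q))) (e (suc k) (s≤s z≤n) ≤-refl)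

∑-zero : ∀ k {f : ℕ → ℕ} → (∀ v → 1 ≤ v → v ≤ k → f v ≡ 0) → ∑ k f ≡ 0
∑-zero zero    e = refl
∑-zero (suc k) e = cong₂ _+_ (∑-zero k (λ v p q → e v p (m≤n⇒m≤1+n q))) (e (suc k) (s≤s z≤n) ≤-refl)

∑-distrib-+ : ∀ k (f g : ℕ → ℕ) → ∑ k (λ v → f v + g v) ≡ ∑ k f + ∑ k g
∑-distrib-+ zero    f g = refl
∑-distrib-+ (suc k) f g rewrite ∑-distrib-+ k f g = interchange (∑ k f) (∑ k g) (f (suc k)) (g (suc k))
  where
  interchange : ∀ a b c d → a + b + (c + d) ≡ a + c + (b + d)
  interchange = solve-∀

∑-unfoldˡ : ∀ k (f : ℕ → ℕ) → ∑ (suc k) f ≡ f 1 + ∑ k (λ v → f (suc v))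
∑-unfoldˡ zero    f = +-comm 0 (f 1)
∑-unfoldˡ (suc k) f rewrite ∑-unfoldˡ k f = +-assoc (f 1) (∑ k (λ v → f (suc v))) (f (suc (suc k)))

∑-*ˡ : ∀ k c (f : ℕ → ℕ) → c * ∑ k f ≡ ∑ k (λ v → c * f v)
∑-*ˡ zero    c f = *-zeroʳ c
∑-*ˡ (suc k) c f rewrite *-distribˡ-+ c (∑ k f) (f (suc k)) | ∑-*ˡ k c f = refl

∑-comm : ∀ m k (F : ℕ → ℕ → ℕ) → ∑ m (λ y → ∑ k (F y)) ≡ ∑ k (λ x → ∑ m (λ y → F y x))
∑-comm zero    k F = sym (∑-zero k (λ _ _ _ → refl))
∑-comm (suc m) k F rewrite ∑-comm m k F = sym (∑-distrib-+ k (λ x → ∑ m (λ y → F y x)) (F (suc m)))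

∑-mono-range : ∀ {k m} (f : ℕ → ℕ) → k ≤ m → ∑ k f ≤ ∑ m f
∑-mono-range {k} {zero}  f z≤n = ≤-refl
∑-mono-range {k} {suc m} f k≤1+m with m≤n⇒m<n∨m≡n k≤1+m
... | inj₂ refl      = ≤-refl
... | inj₁ (s≤s k≤m) = ≤-trans (∑-mono-range f k≤m) (m≤m+n (∑ m f) _)

∑-vanishing-tail : ∀ {k m} (f : ℕ → ℕ) → k ≤ m → (∀ v → k < v → v ≤ m → f v ≡ 0) → ∑ m f ≡ ∑ k f
∑-vanishing-tail {k} {zero}  f z≤n e = refl
∑-vanishing-tail {k} {suc m} f k≤1+m e with m≤n⇒m<n∨m≡n k≤1+m
... | inj₂ refl = refl
... | inj₁ (s≤s k≤m) rewrite e (suc m) (s≤s k≤m) ≤-refl | +-identityʳ (∑ m f) =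
  ∑-vanishing-tail f k≤m (λ v p q → e v p (m≤n⇒m≤1+n q))

pointwise-≡-of-∑-≤ : ∀ k {f g : ℕ → ℕ} → ∑ k f ≤ ∑ k g → (∀ v → 1 ≤ v → v ≤ k → g v ≤ f v)
                   → ∀ v → 1 ≤ v → v ≤ k → f v ≡ g v
pointwise-≡-of-∑-≤ k {f} {g} ∑f≤∑g g≤f v 1≤v v≤k = ≤-antisym (go k ∑f≤∑g g≤f v≤k) (g≤f v 1≤v v≤k)
  where
  go : ∀ k → ∑ k f ≤ ∑ k g → (∀ v → 1 ≤ v → v ≤ k → g v ≤ f v) → v ≤ k → f v ≤ g v
  go zero    _   _   v≤0   = ⊥-elim (<⇒≱ 1≤v v≤0)
  go (suc k) le ge v≤1+k with m≤n⇒m<n∨m≡n v≤1+k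
  ... | inj₂ refl =
    +-cancelˡ-≤ (∑ k g) _ _ (≤-trans (+-monoˡ-≤ (f (suc k)) (∑-mono k (λ u p q → ge u p (m≤n⇒m≤1+n q)))) le)
  ... | inj₁ (s≤s v≤k) =
    go k (+-cancelʳ-≤ (g (suc k)) (∑ k f) (∑ k g) (≤-trans (+-monoʳ-≤ (∑ k f) (ge (suc k) (s≤s z≤n) ≤-refl)) le))
         (λ u p q → ge u p (m≤n⇒m≤1+n q)) v≤k

∑-δ-out : ∀ k p → k < p → ∑ k (λ v → 𝟙 (p ≡ᵇ v)) ≡ 0
∑-δ-out k p k<p =
  ∑-zero k (λ v _ v≤k → cong 𝟙 (≢⇒≡ᵇ≡false (λ p≡v → <⇒≱ k<p (subst (_≤ k) (sym p≡v) v≤k))))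

∑-δ : ∀ k p → 1 ≤ p → p ≤ k → ∑ k (λ v → 𝟙 (p ≡ᵇ v)) ≡ 1
∑-δ zero    p 1≤p p≤0 = ⊥-elim (<⇒≱ 1≤p p≤0)
∑-δ (suc k) p 1≤p p≤1+k with m≤n⇒m<n∨m≡n p≤1+k
... | inj₂ refl rewrite ∑-δ-out k (suc k) ≤-refl | ≡ᵇ-refl k = refl
... | inj₁ (s≤s p≤k) rewrite ∑-δ k p 1≤p p≤k
                           | ≢⇒≡ᵇ≡false {p} {suc k} (λ e → <⇒≱ (s≤s p≤k) (≤-reflexive (sym e))) = refl

∑-δ≤1 : ∀ k p → ∑ k (λ v → 𝟙 (p ≡ᵇ v)) ≤ 1
∑-δ≤1 k zero    = ≤-trans (≤-reflexive (∑-zero k (λ { (suc v) _ _ → refl }))) z≤n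
∑-δ≤1 k (suc p) with suc p ≤? k
... | yes p<k = ≤-reflexive (∑-δ k (suc p) (s≤s z≤n) p<k)
... | no  p≮k = ≤-trans (≤-reflexive (∑-δ-out k (suc p) (≰⇒> p≮k))) z≤n

∑-δ-* : ∀ k p (g : ℕ → ℕ) → 1 ≤ p → p ≤ k → ∑ k (λ v → 𝟙 (p ≡ᵇ v) * g v) ≡ g p
∑-δ-* k p g 1≤p p≤k = begin
    ∑ k (λ v → 𝟙 (p ≡ᵇ v) * g v)  ≡⟨ ∑-cong k (λ v _ _ → δ-swap v) ⟩
    ∑ k (λ v → g p * 𝟙 (p ≡ᵇ v))  ≡⟨ ∑-*ˡ k (g p) _ ⟨
    g p * ∑ k (λ v → 𝟙 (p ≡ᵇ v))  ≡⟨ cong (g p *_) (∑-δ k p 1≤p p≤k) ⟩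
    g p * 1                        ≡⟨ *-identityʳ (g p) ⟩
    g p                            ∎
  where
  open ≡-Reasoning
  δ-swap : ∀ v → 𝟙 (p ≡ᵇ v) * g v ≡ g p * 𝟙 (p ≡ᵇ v)
  δ-swap v with p ≡ᵇ v in e
  ... | true  rewrite ≡ᵇ≡true⇒≡ {p} {v} e = *-comm 1 (g v)
  ... | false = sym (*-zeroʳ (g p))

∑-𝟙≤ : ∀ k b → b ≤ k → ∑ k (λ v → 𝟙 (v ≤ᵇ b)) ≡ b
∑-𝟙≤ zero    .zero z≤n = refl
∑-𝟙≤ (suc k) b b≤1+k with m≤n⇒m<n∨m≡n b≤1+k
... | inj₁ (s≤s b≤k) rewrite ∑-𝟙≤ k b b≤k | >⇒≤ᵇ≡false {suc k} {b} (s≤s b≤k) = +-identityʳ b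
... | inj₂ refl rewrite ∑-cong k {λ v → 𝟙 (v ≤ᵇ suc k)} {λ _ → 1}
                                (λ v _ v≤k → cong 𝟙 (≤⇒≤ᵇ≡true (m≤n⇒m≤1+n v≤k)))
                      | ≤⇒≤ᵇ≡true (≤-refl {suc k}) = trans (cong (_+ 1) (∑-const k)) (+-comm k 1)
  where
  ∑-const : ∀ k → ∑ k (λ _ → 1) ≡ k
  ∑-const zero    = refl
  ∑-const (suc k) = trans (cong (_+ 1) (∑-const k)) (+-comm k 1)

psum≡∑ : ∀ x j → psum x j ≡ ∑ j (at x)
psum≡∑ x        zero    = refl
psum≡∑ []       (suc j) = sym (∑-zero (suc j) (λ _ _ _ → refl))
psum≡∑ (x ∷ xs) (suc j) = begin
  x + psum xs j                                    ≡⟨ cong (x +_) (psum≡∑ xs j) ⟩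
  x + ∑ j (at xs)                                  ≡⟨ cong (x +_) (∑-cong j (λ { (suc v) _ _ → refl })) ⟩
  at (x ∷ xs) 1 + ∑ j (λ v → at (x ∷ xs) (suc v))  ≡⟨ ∑-unfoldˡ j (at (x ∷ xs)) ⟨
  ∑ (suc j) (at (x ∷ xs))                          ∎
  where open ≡-Reasoning

psum[] : ∀ j → psum [] j ≡ 0
psum[] zero    = refl
psum[] (suc j) = refl

psum-suc : ∀ x j → psum x (suc j) ≡ psum x j + at x (suc j)
psum-suc x j rewrite psum≡∑ x (suc j) | psum≡∑ x j = refl

psum-mono : ∀ x {j k} → j ≤ k → psum x j ≤ psum x k
psum-mono x {j} {k} j≤k rewrite psum≡∑ x j | psum≡∑ x k = ∑-mono-range (at x) j≤k

psum-all : ∀ x j → length x ≤ j → psum x j ≡ sum x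
psum-all []       zero    _         = refl
psum-all []       (suc j) _         = refl
psum-all (x ∷ xs) (suc j) (s≤s len≤j) = cong (x +_) (psum-all xs j len≤j)

psum≤sum : ∀ x j → psum x j ≤ sum x
psum≤sum x j with j ≤? length x
... | yes j≤len = subst (psum x j ≤_) (psum-all x (length x) ≤-refl) (psum-mono x j≤len)
... | no  j≰len = ≤-reflexive (psum-all x j (<⇒≤ (≰⇒> j≰len)))

at-beyond-length : ∀ x y → length x < y → at x y ≡ 0
at-beyond-length []       y             _           = refl
at-beyond-length (x ∷ xs) (suc (suc y)) (s≤s len<y) = at-beyond-length xs (suc y) len<y

at≤sum : ∀ x y → at x y ≤ sum x
at≤sum []       y             = z≤n
at≤sum (x ∷ xs) zero          = z≤n
at≤sum (x ∷ xs) (suc zero)    = m≤m+n x (sum xs)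
at≤sum (x ∷ xs) (suc (suc y)) = ≤-trans (at≤sum xs (suc y)) (m≤n+m (sum xs) x)

length≤sum : ∀ x → All (1 ≤_) x → length x ≤ sum x
length≤sum []       []         = z≤n
length≤sum (x ∷ xs) (1≤x ∷ ps) = +-mono-≤ 1≤x (length≤sum xs ps)

at-stripZeros : ∀ x y → at (stripZeros x) y ≡ at x y
at-stripZeros []       y = refl
at-stripZeros (x ∷ xs) y with stripZeros xs | at-stripZeros xs
at-stripZeros (x ∷ xs) zero          | [] | ih with x ≤ᵇ 0
... | true  = refl
... | false = refl
at-stripZeros (x ∷ xs) (suc zero)    | [] | ih with x ≤ᵇ 0 in e
... | true  = sym (n≤0⇒n≡0 (≤ᵇ≡true⇒≤ e))
... | false = refl
at-stripZeros (x ∷ xs) (suc (suc y)) | [] | ih with x ≤ᵇ 0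
... | true  = ih (suc y)
... | false = ih (suc y)
at-stripZeros (x ∷ xs) zero          | _ ∷ _ | ih = refl
at-stripZeros (x ∷ xs) (suc zero)    | _ ∷ _ | ih = refl
at-stripZeros (x ∷ xs) (suc (suc y)) | _ ∷ _ | ih = ih (suc y)

-- No trailing zero, so the length is determined by the entries.
LastPositive : List ℕ → Set
LastPositive []           = ⊤
LastPositive (x ∷ [])     = 1 ≤ x
LastPositive (x ∷ y ∷ ys) = LastPositive (y ∷ ys)

lastPositive-stripZeros : ∀ x → LastPositive (stripZeros x)
lastPositive-stripZeros []       = tt
lastPositive-stripZeros (x ∷ xs) with stripZeros xs | lastPositive-stripZeros xs
... | []    | _ with x ≤ᵇ 0 in e
...   | true  = tt
...   | false = ≤ᵇ≡false⇒> e
lastPositive-stripZeros (x ∷ xs) | _ ∷ _ | ih = ih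

lastPositive-at-length : ∀ z zs → LastPositive (z ∷ zs) → 1 ≤ at (z ∷ zs) (length (z ∷ zs))
lastPositive-at-length z []       p = p
lastPositive-at-length z (y ∷ ys) p = lastPositive-at-length y ys p

lastPositive-length≤ : ∀ x K → LastPositive x → (∀ y → K < y → at x y ≡ 0) → length x ≤ K
lastPositive-length≤ []       K _ _ = z≤n
lastPositive-length≤ (z ∷ zs) K p vanish with length (z ∷ zs) ≤? K
... | yes len≤K = len≤K
... | no  len≰K = ⊥-elim (<⇒≱ (lastPositive-at-length z zs p)
                               (≤-reflexive (vanish (length (z ∷ zs)) (≰⇒> len≰K))))

allPositive⇒lastPositive : ∀ x → All (1 ≤_) x → LastPositive x
allPositive⇒lastPositive []           []           = tt
allPositive⇒lastPositive (x ∷ [])     (p ∷ [])     = p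
allPositive⇒lastPositive (x ∷ y ∷ ys) (_ ∷ ps)     = allPositive⇒lastPositive (y ∷ ys) ps

at-decAt′ : ∀ x k y → 1 ≤ k → at (decAt′ x k) y ≡ at x y ∸ 𝟙 (k ≡ᵇ y)
at-decAt′ []       k             y             _ = sym (0∸n≡0 (𝟙 (k ≡ᵇ y)))
at-decAt′ (x ∷ xs) (suc zero)    zero          _ = refl
at-decAt′ (x ∷ xs) (suc zero)    (suc zero)    _ = refl
at-decAt′ (x ∷ xs) (suc zero)    (suc (suc y)) _ = refl
at-decAt′ (x ∷ xs) (suc (suc k)) zero          _ = refl
at-decAt′ (x ∷ xs) (suc (suc k)) (suc zero)    _ = refl
at-decAt′ (x ∷ xs) (suc (suc k)) (suc (suc y)) _ = at-decAt′ xs (suc k) (suc y) (s≤s z≤n)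

at-decAt : ∀ x k y → 1 ≤ k → at (decAt x k) y ≡ at x y ∸ 𝟙 (k ≡ᵇ y)
at-decAt x k y 1≤k = trans (at-stripZeros (decAt′ x k) y) (at-decAt′ x k y 1≤k)

at-decAt-+δ : ∀ x k y → 1 ≤ k → 1 ≤ at x k → at (decAt x k) y + 𝟙 (k ≡ᵇ y) ≡ at x y
at-decAt-+δ x k y 1≤k 1≤xₖ rewrite at-decAt x k y 1≤k with k ≡ᵇ y in e
... | true rewrite ≡ᵇ≡true⇒≡ {k} {y} e = m∸n+n≡m 1≤xₖ
... | false = +-identityʳ (at x y)

lastPositive-decAt : ∀ x k → LastPositive (decAt x k)
lastPositive-decAt x k = lastPositive-stripZeros (decAt′ x k)

count : List ℕ → ℕ → ℕ
count []       y = 0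
count (k ∷ ks) y = 𝟙 (k ≡ᵇ y) + count ks y

count-∷ʳ : ∀ xs x y → count (xs ∷ʳ x) y ≡ count xs y + 𝟙 (x ≡ᵇ y)
count-∷ʳ []       x y = +-identityʳ (𝟙 (x ≡ᵇ y))
count-∷ʳ (k ∷ xs) x y = trans (cong (𝟙 (k ≡ᵇ y) +_) (count-∷ʳ xs x y)) (sym (+-assoc (𝟙 (k ≡ᵇ y)) _ _))

count-take : ∀ i xs y → count (take i xs) y ≤ count xs y
count-take zero    xs       y = z≤n
count-take (suc i) []       y = z≤n
count-take (suc i) (x ∷ xs) y = +-monoʳ-≤ (𝟙 (x ≡ᵇ y)) (count-take i xs y)

count-beyond : ∀ ks y → All (_< y) ks → count ks y ≡ 0
count-beyond []       y []           = refl
count-beyond (k ∷ ks) y (k<y ∷ ps) rewrite ≢⇒≡ᵇ≡false {k} {y} (<⇒≢ k<y) = count-beyond ks y ps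

∑-count : ∀ j ks → All (λ k → 1 ≤ k × k ≤ j) ks → ∑ j (count ks) ≡ length ks
∑-count j []       []                 = ∑-zero j (λ _ _ _ → refl)
∑-count j (k ∷ ks) ((1≤k , k≤j) ∷ ps) = begin
  ∑ j (λ y → 𝟙 (k ≡ᵇ y) + count ks y)       ≡⟨ ∑-distrib-+ j _ _ ⟩
  ∑ j (λ y → 𝟙 (k ≡ᵇ y)) + ∑ j (count ks)   ≡⟨ cong₂ _+_ (∑-δ j k 1≤k k≤j) (∑-count j ks ps) ⟩
  suc (length ks)                            ∎
  where open ≡-Reasoning

at-decAll-+count : ∀ ν ks → (∀ y → 1 ≤ y → count ks y ≤ at ν y) → All (1 ≤_) ks
                 → ∀ y → 1 ≤ y → at (decAll ν ks) y + count ks y ≡ at ν y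
at-decAll-+count ν []       _      _          y _   = +-identityʳ _
at-decAll-+count ν (k ∷ ks) enough (1≤k ∷ ps) y 1≤y = begin
    at (decAll ν′ ks) y + (𝟙 (k ≡ᵇ y) + count ks y)  ≡⟨ rearrange (at (decAll ν′ ks) y) (𝟙 (k ≡ᵇ y)) (count ks y) ⟩
    at (decAll ν′ ks) y + count ks y + 𝟙 (k ≡ᵇ y)    ≡⟨ cong (_+ 𝟙 (k ≡ᵇ y)) (at-decAll-+count ν′ ks enough′ ps y 1≤y) ⟩
    at ν′ y + 𝟙 (k ≡ᵇ y)                             ≡⟨ at-decAt-+δ ν k y 1≤k 1≤νₖ ⟩
    at ν y                                            ∎
  where
  open ≡-Reasoning
  ν′ = decAt ν k
  rearrange : ∀ a b c → a + (b + c) ≡ a + c + b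
  rearrange = solve-∀
  1≤νₖ : 1 ≤ at ν k
  1≤νₖ = ≤-trans (≤-trans (≤-reflexive (cong 𝟙 (sym (≡ᵇ-refl k)))) (m≤m+n _ _)) (enough k 1≤k)
  enough′ : ∀ y → 1 ≤ y → count ks y ≤ at ν′ y
  enough′ y 1≤y rewrite at-decAt ν k y 1≤k =
    ≤-trans (≤-reflexive (sym (m+n∸m≡n (𝟙 (k ≡ᵇ y)) (count ks y)))) (∸-monoˡ-≤ (𝟙 (k ≡ᵇ y)) (enough y 1≤y))

lastPositive-decAll : ∀ ν ks → LastPositive ν → LastPositive (decAll ν ks)
lastPositive-decAll ν []       p = p
lastPositive-decAll ν (k ∷ ks) _ = lastPositive-decAll (decAt ν k) ks (lastPositive-decAt ν k)

NonIncreasing : List ℕ → Set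
NonIncreasing = Linked _≥_

sum-insertDesc : ∀ x L → sum (insertDesc x L) ≡ x + sum L
sum-insertDesc x []       = refl
sum-insertDesc x (y ∷ ys) with y ≤ᵇ x
... | true  = refl
... | false rewrite sum-insertDesc x ys = +-exchange y x (sum ys)
  where
  +-exchange : ∀ a b c → a + (b + c) ≡ b + (a + c)
  +-exchange = solve-∀

sum-lam : ∀ x → sum (lam x) ≡ sum x
sum-lam []       = refl
sum-lam (x ∷ xs) rewrite sum-insertDesc x (lam xs) | sum-lam xs = refl

insertDesc-below : ∀ x y L → x ≤ y → NonIncreasing (y ∷ L) → NonIncreasing (y ∷ insertDesc x L)
insertDesc-below x y []       x≤y _          = x≤y ∷ [-]
insertDesc-below x y (z ∷ zs) x≤y (z≤y ∷ s) with z ≤ᵇ x in e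
... | true  = x≤y ∷ (≤ᵇ≡true⇒≤ e ∷ s)
... | false = z≤y ∷ insertDesc-below x z zs (<⇒≤ (≤ᵇ≡false⇒> e)) s

insertDesc-nonIncreasing : ∀ x L → NonIncreasing L → NonIncreasing (insertDesc x L)
insertDesc-nonIncreasing x []       _ = [-]
insertDesc-nonIncreasing x (z ∷ zs) s with z ≤ᵇ x in e
... | true  = ≤ᵇ≡true⇒≤ e ∷ s
... | false = insertDesc-below x z zs (<⇒≤ (≤ᵇ≡false⇒> e)) s

lam-nonIncreasing : ∀ x → NonIncreasing (lam x)
lam-nonIncreasing []       = []
lam-nonIncreasing (x ∷ xs) = insertDesc-nonIncreasing x (lam xs) (lam-nonIncreasing xs)

psum-tail≤ : ∀ y ys → NonIncreasing (y ∷ ys) → ∀ j → psum ys j ≤ psum (y ∷ ys) j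
psum-tail≤ y []       _         j rewrite psum[] j = z≤n
psum-tail≤ y (z ∷ zs) _         zero    = z≤n
psum-tail≤ y (z ∷ zs) (z≤y ∷ s) (suc j) = +-mono-≤ z≤y (psum-tail≤ z zs s j)

nonIncreasing-tail : ∀ {y ys} → NonIncreasing (y ∷ ys) → NonIncreasing ys
nonIncreasing-tail [-]     = []
nonIncreasing-tail (_ ∷ s) = s

-- Inserting x into a non-increasing list: the best j+1 parts either avoid x or use x and the best j others.
psum-insertDesc : ∀ x L → NonIncreasing L → ∀ j → psum (insertDesc x L) (suc j) ≡ psum L (suc j) ⊔ (x + psum L j)
psum-insertDesc x []       _ j = refl
psum-insertDesc x (y ∷ ys) s j with y ≤ᵇ x in e
... | true  = sym (m≤n⇒m⊔n≡n (+-mono-≤ (≤ᵇ≡true⇒≤ e) (psum-tail≤ y ys s j)))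
... | false with j
...   | zero   = sym (m≥n⇒m⊔n≡m (+-monoˡ-≤ 0 (<⇒≤ (≤ᵇ≡false⇒> e))))
...   | suc j′ rewrite psum-insertDesc x ys (nonIncreasing-tail s) j′ =
  trans (+-distribˡ-⊔ y _ _) (cong ((y + psum ys (suc j′)) ⊔_) (+-exchange y x (psum ys j′)))
  where
  +-exchange : ∀ a b c → a + (b + c) ≡ b + (a + c)
  +-exchange = solve-∀

psum-insertDesc-mono : ∀ x L L′ → NonIncreasing L → NonIncreasing L′ → (∀ j → psum L′ j ≤ psum L j)
                     → ∀ j → psum (insertDesc x L′) j ≤ psum (insertDesc x L) j
psum-insertDesc-mono x L L′ s s′ d zero    = z≤n
psum-insertDesc-mono x L L′ s s′ d (suc j) rewrite psum-insertDesc x L s j | psum-insertDesc x L′ s′ j =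
  ⊔-mono-≤ (d (suc j)) (+-monoʳ-≤ x (d j))

tilde-∷ : ∀ x y ys → tilde (x ∷ y ∷ ys) ≡ x ∷ tilde (y ∷ ys)
tilde-∷ zero          y ys = refl
tilde-∷ (suc zero)    y ys = refl
tilde-∷ (suc (suc x)) y ys = refl

psum-lam-tilde≤ : ∀ x j → psum (lam (tilde x)) j ≤ psum (lam x) j
psum-lam-tilde≤ []                  j = ≤-refl
psum-lam-tilde≤ (zero ∷ [])         j rewrite psum[] j = z≤n
psum-lam-tilde≤ (suc zero ∷ [])     j rewrite psum[] j = z≤n
psum-lam-tilde≤ (suc (suc x) ∷ [])  zero    = z≤n
psum-lam-tilde≤ (suc (suc x) ∷ [])  (suc j) = +-monoˡ-≤ (psum [] j) (n≤1+n (suc x))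
psum-lam-tilde≤ (x ∷ y ∷ ys)        j =
  subst (λ w → psum (lam w) j ≤ psum (lam (x ∷ y ∷ ys)) j) (sym (tilde-∷ x y ys))
    (psum-insertDesc-mono x (lam (y ∷ ys)) (lam (tilde (y ∷ ys)))
      (lam-nonIncreasing (y ∷ ys)) (lam-nonIncreasing (tilde (y ∷ ys))) (psum-lam-tilde≤ (y ∷ ys)) j)

consMask : Bool → (ℕ → Bool) → ℕ → Bool
consMask b M zero          = false
consMask b M (suc zero)    = b
consMask b M (suc (suc v)) = M (suc v)

∑-consMask-size : ∀ L b M → ∑ (suc L) (λ v → 𝟙 (consMask b M v)) ≡ 𝟙 b + ∑ L (λ v → 𝟙 (M v))
∑-consMask-size L b M = trans (∑-unfoldˡ L _) (cong (𝟙 b +_) (∑-cong L (λ { (suc v) _ _ → refl })))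

∑-consMask-value : ∀ L b M x xs → ∑ (suc L) (λ v → 𝟙 (consMask b M v) * at (x ∷ xs) v)
                                 ≡ 𝟙 b * x + ∑ L (λ v → 𝟙 (M v) * at xs v)
∑-consMask-value L b M x xs = trans (∑-unfoldˡ L _) (cong (𝟙 b * x +_) (∑-cong L (λ { (suc v) _ _ → refl })))

lam-psum-selection : ∀ x j → Σ (ℕ → Bool) (λ M → ∑ (length x) (λ v → 𝟙 (M v)) ≤ j
                                            × psum (lam x) j ≤ ∑ (length x) (λ v → 𝟙 (M v) * at x v))
lam-psum-selection []       j       = (λ _ → false) , z≤n , ≤-reflexive (psum[] j)
lam-psum-selection (x ∷ xs) zero    = (λ _ → false) , ≤-reflexive (∑-zero (suc (length xs)) (λ _ _ _ → refl)) , z≤n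
lam-psum-selection (x ∷ xs) (suc j) with ⊔-sel (psum (lam xs) (suc j)) (x + psum (lam xs) j)
... | inj₁ skip-x with lam-psum-selection xs (suc j)
...   | M , size , value = consMask false M ,
        ≤-trans (≤-reflexive (∑-consMask-size (length xs) false M)) size ,
        ≤-trans (≤-reflexive (trans (psum-insertDesc x (lam xs) (lam-nonIncreasing xs) j) skip-x))
                (≤-trans value (≤-reflexive (sym (∑-consMask-value (length xs) false M x xs))))
lam-psum-selection (x ∷ xs) (suc j) | inj₂ take-x with lam-psum-selection xs j
...   | M , size , value = consMask true M ,
        ≤-trans (≤-reflexive (∑-consMask-size (length xs) true M)) (s≤s size) ,
        ≤-trans (≤-reflexive (trans (psum-insertDesc x (lam xs) (lam-nonIncreasing xs) j) take-x))
                (≤-trans (+-mono-≤ (≤-reflexive (sym (+-identityʳ x))) value)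
                         (≤-reflexive (sym (∑-consMask-value (length xs) true M x xs))))

lastPart-positive⇒nonEmpty : ∀ x → 1 ≤ lastPart x → 1 ≤ length x
lastPart-positive⇒nonEmpty (_ ∷ _) _ = s≤s z≤n

length-tilde≤ : ∀ x → length (tilde x) ≤ length x
length-tilde≤ []                 = z≤n
length-tilde≤ (zero ∷ [])        = z≤n
length-tilde≤ (suc zero ∷ [])    = z≤n
length-tilde≤ (suc (suc x) ∷ []) = ≤-refl
length-tilde≤ (x ∷ y ∷ ys) =
  subst (λ w → length w ≤ _) (sym (tilde-∷ x y ys)) (s≤s (length-tilde≤ (y ∷ ys)))

length-tilde : ∀ x → 2 ≤ lastPart x → length (tilde x) ≡ length x
length-tilde (suc zero ∷ [])    (s≤s ())
length-tilde (suc (suc x) ∷ []) _      = refl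
length-tilde (x ∷ y ∷ ys)       2≤last =
  subst (λ w → length w ≡ _) (sym (tilde-∷ x y ys)) (cong suc (length-tilde (y ∷ ys) 2≤last))

lastPart-∷ : ∀ x w → 1 ≤ length w → lastPart (x ∷ w) ≡ lastPart w
lastPart-∷ x (_ ∷ _) _ = refl

lastPart-tilde : ∀ x → 2 ≤ lastPart x → suc (lastPart (tilde x)) ≡ lastPart x
lastPart-tilde (suc zero ∷ [])    (s≤s ())
lastPart-tilde (suc (suc x) ∷ []) _      = refl
lastPart-tilde (x ∷ y ∷ ys)       2≤last =
  subst (λ w → suc (lastPart w) ≡ _) (sym (tilde-∷ x y ys))
    (trans (cong suc (lastPart-∷ x (tilde (y ∷ ys)) nonEmpty)) (lastPart-tilde (y ∷ ys) 2≤last))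
  where
  nonEmpty : 1 ≤ length (tilde (y ∷ ys))
  nonEmpty = ≤-trans (s≤s z≤n) (≤-reflexive (sym (length-tilde (y ∷ ys) 2≤last)))

sum-tilde : ∀ x → 1 ≤ lastPart x → sum (tilde x) + 1 ≡ sum x
sum-tilde (suc zero ∷ [])    _      = refl
sum-tilde (suc (suc x) ∷ []) _      = cong suc (+-comm (x + 0) 1)
sum-tilde (x ∷ y ∷ ys)       1≤last =
  subst (λ w → sum w + 1 ≡ sum (x ∷ y ∷ ys)) (sym (tilde-∷ x y ys))
    (trans (+-assoc x (sum (tilde (y ∷ ys))) 1) (cong (x +_) (sum-tilde (y ∷ ys) 1≤last)))

at-tilde-+δ : ∀ x → 1 ≤ lastPart x → ∀ v → at (tilde x) v + 𝟙 (length x ≡ᵇ v) ≡ at x v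
at-tilde-+δ (suc zero ∷ [])    _ zero          = refl
at-tilde-+δ (suc zero ∷ [])    _ (suc zero)    = refl
at-tilde-+δ (suc zero ∷ [])    _ (suc (suc v)) = refl
at-tilde-+δ (suc (suc x) ∷ []) _ zero          = refl
at-tilde-+δ (suc (suc x) ∷ []) _ (suc zero)    = cong suc (+-comm x 1)
at-tilde-+δ (suc (suc x) ∷ []) _ (suc (suc v)) = refl
at-tilde-+δ (x ∷ y ∷ ys) _      zero       rewrite tilde-∷ x y ys = refl
at-tilde-+δ (x ∷ y ∷ ys) _      (suc zero) rewrite tilde-∷ x y ys = +-identityʳ x
at-tilde-+δ (x ∷ y ∷ ys) 1≤last (suc (suc v)) =
  subst (λ w → at w (suc (suc v)) + 𝟙 (length (x ∷ y ∷ ys) ≡ᵇ suc (suc v)) ≡ at (x ∷ y ∷ ys) (suc (suc v)))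
    (sym (tilde-∷ x y ys)) (at-tilde-+δ (y ∷ ys) 1≤last (suc v))

tilde^ : ℕ → List ℕ → List ℕ
tilde^ zero    a = a
tilde^ (suc i) a = tilde (tilde^ i a)

length-tilde^≤ : ∀ i a → length (tilde^ i a) ≤ length a
length-tilde^≤ zero    a = ≤-refl
length-tilde^≤ (suc i) a = ≤-trans (length-tilde≤ (tilde^ i a)) (length-tilde^≤ i a)

module Iterates (a : List ℕ) where

  shape-tilde^ : ∀ i → i < lastPart a → length (tilde^ i a) ≡ length a × lastPart (tilde^ i a) + i ≡ lastPart a
  shape-tilde^ zero    _   = refl , +-identityʳ (lastPart a)
  shape-tilde^ (suc i) i<c with shape-tilde^ i (<⇒≤ i<c)
  ... | len≡ , last≡ = trans (length-tilde (tilde^ i a) 2≤last) len≡ ,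
                       trans (+-suc (lastPart (tilde^ (suc i) a)) i) (trans (cong (_+ i) (lastPart-tilde (tilde^ i a) 2≤last)) last≡)
    where
    2≤last : 2 ≤ lastPart (tilde^ i a)
    2≤last = +-cancelʳ-≤ i 2 _ (subst (2 + i ≤_) (sym last≡) i<c)

  lastPart-tilde^-positive : ∀ i → i < lastPart a → 1 ≤ lastPart (tilde^ i a)
  lastPart-tilde^-positive i i<c = +-cancelʳ-≤ i 1 _ (subst (suc i ≤_) (sym (proj₂ (shape-tilde^ i i<c))) i<c)

  at-tilde^ : ∀ i → i ≤ lastPart a → ∀ v → at (tilde^ i a) v + 𝟙 (length a ≡ᵇ v) * i ≡ at a v
  at-tilde^ zero    _   v = trans (cong (at a v +_) (*-zeroʳ (𝟙 (length a ≡ᵇ v)))) (+-identityʳ _)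
  at-tilde^ (suc i) i<c v = begin
      at (tilde x) v + δ * suc i      ≡⟨ cong (at (tilde x) v +_) (*-suc δ i) ⟩
      at (tilde x) v + (δ + δ * i)    ≡⟨ +-assoc (at (tilde x) v) _ _ ⟨
      at (tilde x) v + δ + δ * i      ≡⟨ cong (λ h → at (tilde x) v + 𝟙 (h ≡ᵇ v) + δ * i) (sym (proj₁ (shape-tilde^ i i<c))) ⟩
      at (tilde x) v + 𝟙 (length x ≡ᵇ v) + δ * i  ≡⟨ cong (_+ δ * i) (at-tilde-+δ x (lastPart-tilde^-positive i i<c) v) ⟩
      at x v + δ * i                  ≡⟨ at-tilde^ i (<⇒≤ i<c) v ⟩
      at a v                          ∎
    where
    open ≡-Reasoning
    x = tilde^ i a
    δ = 𝟙 (length a ≡ᵇ v)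

  sum-tilde^ : ∀ i → i ≤ lastPart a → sum (tilde^ i a) + i ≡ sum a
  sum-tilde^ zero    _   = +-identityʳ _
  sum-tilde^ (suc i) i<c = trans (sym (+-assoc (sum (tilde^ (suc i) a)) 1 i))
    (trans (cong (_+ i) (sum-tilde (tilde^ i a) (lastPart-tilde^-positive i i<c))) (sum-tilde^ i (<⇒≤ i<c)))

lam-psum-selection-within : ∀ x j H → length x ≤ H
  → Σ (ℕ → Bool) (λ M → ∑ H (λ v → 𝟙 (M v)) ≤ j × psum (lam x) j ≤ ∑ H (λ v → 𝟙 (M v) * at x v))
lam-psum-selection-within x j H len≤H with lam-psum-selection x j
... | M , size , value = M′ , ≤-trans (≤-reflexive (restricted (λ b _ → 𝟙 b) (λ _ → refl))) size
                            , ≤-trans value (≤-reflexive (sym (restricted (λ b v → 𝟙 b * at x v) (λ _ → refl))))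
  where
  M′ : ℕ → Bool
  M′ v = M v ∧ (v ≤ᵇ length x)
  restricted : ∀ (F : Bool → ℕ → ℕ) → (∀ v → F false v ≡ 0)
             → ∑ H (λ v → F (M′ v) v) ≡ ∑ (length x) (λ v → F (M v) v)
  restricted F F-false = trans
    (∑-vanishing-tail _ len≤H (λ v len<v _ →
      trans (cong (λ b → F (M v ∧ b) v) (>⇒≤ᵇ≡false len<v)) (trans (cong (λ b → F b v) (∧-zeroʳ (M v))) (F-false v))))
    (∑-cong (length x) (λ v _ v≤len →
      cong (λ b → F b v) (trans (cong (M v ∧_) (≤⇒≤ᵇ≡true v≤len)) (∧-identityʳ (M v)))))

seqAlμ-suc : ∀ {a μ r} i {aᵢ lᵢ ρ l′} → seqAlμ a μ r i ≡ just (aᵢ , lᵢ , ρ) → ⌊ i ∈? Aset a ⌋ ≡ false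
           → lmin ρ aᵢ lᵢ ≡ just l′ → seqAlμ a μ r (suc i) ≡ just (tilde aᵢ , l′ , decAt ρ l′)
seqAlμ-suc i e₁ e₂ e₃ rewrite e₁ | e₂ | e₃ = refl

lSeq-just : ∀ {a μ r} i {aᵢ lᵢ ρ} → seqAlμ a μ r i ≡ just (aᵢ , lᵢ , ρ) → lSeq a μ r i ≡ just lᵢ
lSeq-just i e rewrite e = refl

μSeq-just : ∀ {a μ r} i {aᵢ lᵢ ρ} → seqAlμ a μ r i ≡ just (aᵢ , lᵢ , ρ) → μSeq a μ r i ≡ just ρ
μSeq-just i e rewrite e = refl

dom⇒psum≤ : ∀ x y → sum y ≤ sum x → Dom x y → ∀ j → psum y j ≤ psum x j
dom⇒psum≤ x y _     _       zero    = z≤n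
dom⇒psum≤ x y ∑y≤∑x (_ , d) (suc j) with suc j ≤? length x
... | yes j<len = subst (λ z → psum y (suc z) ≤ psum x (suc z)) (toℕ-fromℕ< j<len) (d (fromℕ< j<len))
... | no  j≮len =
  ≤-trans (psum≤sum y (suc j)) (≤-trans ∑y≤∑x (≤-reflexive (sym (psum-all x (suc j) (<⇒≤ (≰⇒> j≮len))))))

-- When x has no trailing zero, dominance of prefix sums already forces length x ≤ length y.
psum≤⇒dom : ∀ x y → LastPositive x → sum x ≤ sum y → (∀ j → psum y j ≤ psum x j) → Dom x y
psum≤⇒dom []       y _   _     _ = z≤n , (λ ())
psum≤⇒dom (z ∷ zs) y pos ∑x≤∑y d = length≤ , (λ j → d (suc (toℕ j)))
  where
  length≤ : length (z ∷ zs) ≤ length y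
  length≤ with length (z ∷ zs) ≤? length y
  ... | yes len≤ = len≤
  ... | no  len≰ = ⊥-elim (<⇒≱ ∑y<∑x ∑x≤∑y)
    where
    open ≤-Reasoning
    k = length y
    ∑y<∑x : sum y < sum (z ∷ zs)
    ∑y<∑x = begin-strict
      sum y                       ≡⟨ psum-all y k ≤-refl ⟨
      psum y k                    ≤⟨ d k ⟩
      psum (z ∷ zs) k             ≤⟨ psum-mono (z ∷ zs) (s≤s⁻¹ (≰⇒> len≰)) ⟩
      psum (z ∷ zs) (length zs)   <⟨ m<m+n _ (lastPositive-at-length z zs pos) ⟩
      psum (z ∷ zs) (length zs) + at (z ∷ zs) (length (z ∷ zs))  ≡⟨ psum-suc (z ∷ zs) (length zs) ⟨
      psum (z ∷ zs) (length (z ∷ zs))                            ≡⟨ psum-all (z ∷ zs) _ ≤-refl ⟩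
      sum (z ∷ zs)                ∎

<-head : ∀ {z x} zs → Linked _<_ (z ∷ zs) → x ∈ zs → z < x
<-head (w ∷ ws) (z<w ∷ _) (here refl) = z<w
<-head (w ∷ ws) (z<w ∷ l) (there x∈)  = <-trans z<w (<-head ws l x∈)

<-tail : ∀ {z} zs → Linked _<_ (z ∷ zs) → Linked _<_ zs
<-tail []       _       = []
<-tail (w ∷ ws) (_ ∷ l) = l

firstSat-≤ : ∀ {P : ℕ → Set} (P? : (x : ℕ) → Dec (P x)) xs → Linked _<_ xs → ∀ {x} → x ∈ xs → P x
           → Σ ℕ (λ y → firstSat P? xs ≡ just y × P y × y ≤ x)
firstSat-≤ P? (z ∷ zs) lk x∈ px with P? z
... | yes pz = z , refl , pz , head≤ x∈
  where
  head≤ : ∀ {x} → x ∈ z ∷ zs → z ≤ x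
  head≤ (here refl) = ≤-refl
  head≤ (there x∈)  = <⇒≤ (<-head zs lk x∈)
... | no ¬pz with x∈
...   | here refl = ⊥-elim (¬pz px)
...   | there x∈′ = firstSat-≤ P? zs (<-tail zs lk) x∈′ px

applyUpTo-increasing : ∀ (f : ℕ → ℕ) → (∀ n → f n < f (suc n)) → ∀ m → Linked _<_ (applyUpTo f m)
applyUpTo-increasing f inc zero          = []
applyUpTo-increasing f inc (suc zero)    = [-]
applyUpTo-increasing f inc (suc (suc m)) = inc 0 ∷ applyUpTo-increasing (λ n → f (suc n)) (λ n → inc (suc n)) (suc m)

∈-applyUpTo : ∀ (f : ℕ → ℕ) m k → k < m → f k ∈ applyUpTo f m
∈-applyUpTo f (suc m) zero    _         = here refl
∈-applyUpTo f (suc m) (suc k) (s≤s k<m) = there (∈-applyUpTo (λ n → f (suc n)) m k k<m)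

∈-applyUpTo-suc : ∀ {t m} → 1 ≤ t → t ≤ m → t ∈ applyUpTo suc m
∈-applyUpTo-suc {suc t} {m} _ t<m = ∈-applyUpTo suc m t t<m

lmin-≤ : ∀ ν b lo t → InR ν b t → lo ≤ t → Σ ℕ (λ l → lmin ν b lo ≡ just l × InR ν b l × l ≤ t)
lmin-≤ ν b lo t t∈R@(1≤t , t≤len , _) lo≤t with
  firstSat-≤ (λ r → (lo ≤? r) ×-dec inR? ν b r) (map suc (upTo (length ν)))
    (subst (Linked _<_) (sym (map-applyUpTo id suc (length ν))) (applyUpTo-increasing suc (λ _ → ≤-refl) (length ν)))
    (subst (t ∈_) (sym (map-applyUpTo id suc (length ν))) t∈) (lo≤t , t∈R)
  where
  t∈ : t ∈ applyUpTo suc (length ν)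
  t∈ = ∈-applyUpTo-suc 1≤t t≤len
... | l , eq , (_ , l∈R) , l≤t = l , eq , l∈R , l≤t

reverse-head : ∀ L → 1 ≤ length L → Σ (List ℕ) (λ rest → reverse L ≡ lastPart L ∷ rest)
reverse-head (x ∷ [])     _ = [] , refl
reverse-head (x ∷ y ∷ ys) _ with reverse-head (y ∷ ys) (s≤s z≤n)
... | rest , e = rest ∷ʳ x , trans (unfold-reverse x (y ∷ ys)) (cong (_∷ʳ x) e)

Aset-≥lastPart : ∀ a → 1 ≤ length a → ∀ {x} → x ∈ Aset a → lastPart a ≤ x
Aset-≥lastPart a nonEmpty x∈ with ∈-map⁻ (λ j → sum (take j (reverse a))) x∈
... | k , k∈ , refl with ∈-map⁻ suc k∈
...   | j , _ , refl with reverse-head a nonEmpty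
...     | rest , e rewrite e = m≤m+n (lastPart a) _

∉Aset : ∀ a i → 1 ≤ length a → i < lastPart a → ⌊ i ∈? Aset a ⌋ ≡ false
∉Aset a i nonEmpty i<c with i ∈? Aset a
... | yes i∈ = ⊥-elim (<⇒≱ i<c (Aset-≥lastPart a nonEmpty i∈))
... | no  _  = refl

≤-head-at : ∀ y ys → Linked _≤_ (y ∷ ys) → ∀ i → i ≤ length ys → y ≤ at (y ∷ ys) (suc i)
≤-head-at y ys       _          zero    _         = ≤-refl
≤-head-at y (z ∷ zs) (y≤z ∷ l) (suc i) (s≤s i≤) = ≤-trans y≤z (≤-head-at z zs l i i≤)

at-linked-≤ : ∀ r xs → Linked _≤_ (r ∷ xs) → ∀ k → k < length xs → at (r ∷ xs) (suc k) ≤ at (r ∷ xs) (suc (suc k))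
at-linked-≤ r (y ∷ ys) (r≤y ∷ _) zero    _         = r≤y
at-linked-≤ r (y ∷ ys) (_ ∷ l)   (suc k) (s≤s k<) = at-linked-≤ y ys l k k<

take-linked-bounds : ∀ r xs → Linked _≤_ (r ∷ xs) → ∀ i → i ≤ length xs
                   → All (λ k → r ≤ k × k ≤ at (r ∷ xs) (suc i)) (take i xs)
take-linked-bounds r xs       _          zero    _        = []
take-linked-bounds r (y ∷ ys) (r≤y ∷ l) (suc i) (s≤s i≤) =
  (r≤y , ≤-head-at y ys l i i≤) ∷ All.map (λ { (y≤k , k≤) → ≤-trans r≤y y≤k , k≤ }) (take-linked-bounds y ys l i i≤)

take-suc-∷ʳ : ∀ (xs : List ℕ) i → i < length xs → take (suc i) xs ≡ take i xs ∷ʳ at xs (suc i)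
take-suc-∷ʳ (x ∷ xs) zero    _         = refl
take-suc-∷ʳ (x ∷ xs) (suc i) (s≤s i<) = cong (x ∷_) (take-suc-∷ʳ xs i i<)

at-∈ : ∀ (xs : List ℕ) i → i < length xs → at xs (suc i) ∈ xs
at-∈ (x ∷ xs) zero    _         = here refl
at-∈ (x ∷ xs) (suc i) (s≤s i<) = there (at-∈ xs i i<)

at-antitone : ∀ μ → NonIncreasing μ → ∀ y → 1 ≤ y → at μ (suc y) ≤ at μ y
at-antitone []           _         y             _ = z≤n
at-antitone (x ∷ [])     _         (suc zero)    _ = z≤n
at-antitone (x ∷ [])     _         (suc (suc y)) _ = z≤n
at-antitone (x ∷ z ∷ zs) (z≤x ∷ _) (suc zero)    _ = z≤x
at-antitone (x ∷ z ∷ zs) (_ ∷ l)   (suc (suc y)) _ = at-antitone (z ∷ zs) l (suc y) (s≤s z≤n)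

length-filter : ∀ {A : Set} {P : A → Set} (P? : Decidable P) (L : List A)
              → length (filter P? L) ≡ sum (map (λ z → 𝟙 (does (P? z))) L)
length-filter P? []       = refl
length-filter P? (x ∷ xs) with does (P? x)
... | true  = cong suc (length-filter P? xs)
... | false = length-filter P? xs

sum-map-concatMap : ∀ {A B : Set} (F : B → ℕ) (f : A → List B) (xs : List A)
                  → sum (map F (concatMap f xs)) ≡ sum (map (λ i → sum (map F (f i))) xs)
sum-map-concatMap F f []       = refl
sum-map-concatMap F f (x ∷ xs) = begin
  sum (map F (f x ++ concatMap f xs))                   ≡⟨ cong sum (map-++ F (f x) (concatMap f xs)) ⟩
  sum (map F (f x) ++ map F (concatMap f xs))           ≡⟨ sum-++ (map F (f x)) _ ⟩
  sum (map F (f x)) + sum (map F (concatMap f xs))      ≡⟨ cong (sum (map F (f x)) +_) (sum-map-concatMap F f xs) ⟩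
  sum (map F (f x)) + sum (map (λ i → sum (map F (f i))) xs) ∎
  where open ≡-Reasoning

sum-map-applyUpTo : ∀ (F : ℕ → ℕ) (f : ℕ → ℕ) m → sum (map F (applyUpTo f m)) ≡ ∑ m (λ y → F (f (y ∸ 1)))
sum-map-applyUpTo F f zero    = refl
sum-map-applyUpTo F f (suc m) =
  trans (cong (F (f 0) +_) (trans (sum-map-applyUpTo F (λ n → f (suc n)) m) (∑-cong m (λ { (suc y) _ _ → refl }))))
        (sym (∑-unfoldˡ m (λ y → F (f (y ∸ 1)))))

∑-cells : ∀ (μ : List ℕ) (Q : ℕ → ℕ → ℕ) →
  sum (map (λ c → Q (proj₁ c) (proj₂ c)) (cells μ)) ≡ ∑ (length μ) (λ y → ∑ (at μ y) (Q y))
∑-cells μ Q = begin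
  sum (map Qc (cells μ))
    ≡⟨ sum-map-concatMap Qc _ (upTo (length μ)) ⟩
  sum (map (λ i → sum (map Qc (map (λ j → (suc i , suc j)) (upTo (at μ (suc i)))))) (upTo (length μ)))
    ≡⟨ sum-map-applyUpTo _ id (length μ) ⟩
  ∑ (length μ) (λ y → sum (map Qc (map (λ j → (suc (y ∸ 1) , suc j)) (upTo (at μ (suc (y ∸ 1)))))))
    ≡⟨ ∑-cong (length μ) (λ { (suc y) _ _ → row y }) ⟩
  ∑ (length μ) (λ y → ∑ (at μ y) (Q y)) ∎
  where
  open ≡-Reasoning
  Qc : ℕ × ℕ → ℕ
  Qc c = Q (proj₁ c) (proj₂ c)
  row : ∀ y → sum (map Qc (map (λ j → (suc y , suc j)) (upTo (at μ (suc y))))) ≡ ∑ (at μ (suc y)) (Q (suc y))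
  row y = trans (cong sum (sym (map-∘ (upTo (at μ (suc y))))))
                (trans (sum-map-applyUpTo (λ j → Q (suc y) (suc j)) id (at μ (suc y)))
                       (∑-cong (at μ (suc y)) (λ { (suc x) _ _ → refl })))

fiberSize≡∑ : ∀ T μ v → fiberSize T μ v ≡ ∑ (length μ) (λ y → ∑ (at μ y) (λ x → 𝟙 (T y x ≡ᵇ v)))
fiberSize≡∑ T μ v = trans (length-filter _ (cells μ)) (∑-cells μ (λ y x → 𝟙 (T y x ≡ᵇ v)))

∑-restrict : ∀ N b (g : ℕ → ℕ) → b ≤ N → ∑ N (λ x → 𝟙 (x ≤ᵇ b) * g x) ≡ ∑ b g
∑-restrict N b g b≤N =
  trans (∑-vanishing-tail _ b≤N (λ v b<v _ → cong (λ z → 𝟙 z * g v) (>⇒≤ᵇ≡false b<v)))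
        (∑-cong b (λ v _ v≤b → trans (cong (λ z → 𝟙 z * g v) (≤⇒≤ᵇ≡true v≤b)) (+-identityʳ (g v))))

pointwise-≤-bound : ∀ {ls ts t} → Pointwise _≤_ ls ts → All (_≤ t) ts → All (_≤ t) ls
pointwise-≤-bound []          []           = []
pointwise-≤-bound (l≤t′ ∷ ps) (t′≤t ∷ qs) = ≤-trans l≤t′ t′≤t ∷ pointwise-≤-bound ps qs

count-max-mono : ∀ {ls ts t} → Pointwise _≤_ ls ts → All (_≤ t) ts → count ls t ≤ count ts t
count-max-mono [] [] = z≤n
count-max-mono {l ∷ ls} {t′ ∷ ts} {t} (l≤t′ ∷ ps) (t′≤t ∷ qs) = +-mono-≤ head (count-max-mono ps qs)
  where
  head : 𝟙 (l ≡ᵇ t) ≤ 𝟙 (t′ ≡ᵇ t)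
  head with l ≡ᵇ t in e
  ... | false = z≤n
  ... | true rewrite ≡ᵇ≡true⇒≡ {l} {t} e | ≤-antisym t′≤t l≤t′ | ≡ᵇ-refl t = ≤-refl

count≤ : List ℕ → ℕ → ℕ
count≤ []      j = 0
count≤ (k ∷ L) j = 𝟙 (k ≤ᵇ j) + count≤ L j

count≤-antitone : ∀ {ls ts} j → Pointwise _≤_ ls ts → count≤ ts j ≤ count≤ ls j
count≤-antitone j [] = z≤n
count≤-antitone {l ∷ ls} {t ∷ ts} j (l≤t ∷ ps) = +-mono-≤ head (count≤-antitone j ps)
  where
  head : 𝟙 (t ≤ᵇ j) ≤ 𝟙 (l ≤ᵇ j)
  head with t ≤ᵇ j in e
  ... | false = z≤n
  ... | true rewrite ≤⇒≤ᵇ≡true (≤-trans l≤t (≤ᵇ≡true⇒≤ e)) = ≤-refl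

∑-count≡count≤ : ∀ j L → All (1 ≤_) L → ∑ j (count L) ≡ count≤ L j
∑-count≡count≤ j []      []         = ∑-zero j (λ _ _ _ → refl)
∑-count≡count≤ j (k ∷ L) (1≤k ∷ ps) = trans (∑-distrib-+ j _ _) (cong₂ _+_ head (∑-count≡count≤ j L ps))
  where
  head : ∑ j (λ y → 𝟙 (k ≡ᵇ y)) ≡ 𝟙 (k ≤ᵇ j)
  head with k ≤? j
  ... | yes k≤j rewrite ≤⇒≤ᵇ≡true k≤j = ∑-δ j k 1≤k k≤j
  ... | no  k≰j rewrite >⇒≤ᵇ≡false {k} {j} (≰⇒> k≰j) = ∑-δ-out j k (≰⇒> k≰j)

psum-+∑count : ∀ μ ν ks → (∀ y → 1 ≤ y → at ν y + count ks y ≡ at μ y)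
             → ∀ j → psum ν j + ∑ j (count ks) ≡ psum μ j
psum-+∑count μ ν ks removed j rewrite psum≡∑ ν j | psum≡∑ μ j =
  trans (sym (∑-distrib-+ j _ _)) (∑-cong j (λ y 1≤y _ → removed y 1≤y))

lastPart-positive : ∀ a → All (1 ≤_) a → 1 ≤ length a → 1 ≤ lastPart a
lastPart-positive (x ∷ [])     (1≤x ∷ []) _ = 1≤x
lastPart-positive (x ∷ y ∷ ys) (_ ∷ ps)   _ = lastPart-positive (y ∷ ys) ps (s≤s z≤n)

module DownClosed (B : ℕ → Bool) (down : ∀ y → 1 ≤ y → B (suc y) ≡ true → B y ≡ true) where

  false-above : ∀ k → B (suc k) ≡ false → ∀ y → k < y → B y ≡ false
  false-above k e (suc y) (s≤s k≤y) with m≤n⇒m<n∨m≡n k≤y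
  ... | inj₂ refl = e
  ... | inj₁ k<y with B (suc y) in e′
  ...   | false = refl
  ...   | true  with () ← trans (sym (down y (≤-trans (s≤s z≤n) k<y) e′)) (false-above k e y k<y)

  -- A down-closed subset of 1,2,… either lies inside 1..J or contains all of 1..J.
  ∑-dichotomy : ∀ N J → (∑ N (λ y → 𝟙 (B y)) ≤ ∑ J (λ y → 𝟙 (B y))) ⊎ (J ≤ ∑ J (λ y → 𝟙 (B y)))
  ∑-dichotomy N zero    = inj₂ z≤n
  ∑-dichotomy N (suc J) with B (suc J) in e | ∑-dichotomy N J
  ... | true  | inj₁ le = inj₁ (≤-trans le (m≤m+n _ _))
  ... | true  | inj₂ le = inj₂ (≤-trans (≤-reflexive (+-comm 1 J)) (+-monoˡ-≤ 1 le))
  ... | false | _       = inj₁ (≤-trans bounded (m≤m+n _ _))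
    where
    bounded : ∑ N (λ y → 𝟙 (B y)) ≤ ∑ J (λ y → 𝟙 (B y))
    bounded with N ≤? J
    ... | yes N≤J = ∑-mono-range _ N≤J
    ... | no  N≰J = ≤-reflexive (∑-vanishing-tail _ (<⇒≤ (≰⇒> N≰J)) (λ v J<v _ → cong 𝟙 (false-above J e v J<v)))

module Tableau (n : ℕ) (μ a : List ℕ) (hμ : IsPartition n μ) (T : ℕ → ℕ → ℕ) (hT : IsSTab μ a T) where

  h : ℕ
  h = length a

  μ-positive : All (1 ≤_) μ
  μ-positive = proj₁ (proj₁ hμ)

  sum-μ : sum μ ≡ n
  sum-μ = proj₂ (proj₁ hμ)

  μ-nonIncreasing : NonIncreasing μ
  μ-nonIncreasing = proj₂ hμ

  T-range : ∀ i j → InD μ i j → 1 ≤ T i j × T i j ≤ h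
  T-range = proj₁ hT

  T-column-strict : ∀ i j → InD μ i j → InD μ (suc i) j → T i j < T (suc i) j
  T-column-strict = proj₁ (proj₂ (proj₂ hT))

  T-content : ∀ v → 1 ≤ v → v ≤ h → fiberSize T μ v ≡ at a v
  T-content = proj₂ (proj₂ (proj₂ hT))

  length-μ≤n : length μ ≤ n
  length-μ≤n = subst (length μ ≤_) sum-μ (length≤sum μ μ-positive)

  at-μ≤n : ∀ y → at μ y ≤ n
  at-μ≤n y = subst (at μ y ≤_) sum-μ (at≤sum μ y)

  row-exists : ∀ y → 1 ≤ at μ y → y ≤ length μ
  row-exists y 1≤μy with y ≤? length μ
  ... | yes y≤ = y≤
  ... | no  y≰ = ⊥-elim (<⇒≱ 1≤μy (≤-reflexive (at-beyond-length μ y (≰⇒> y≰))))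

  inD : ∀ {y x} → 1 ≤ y → 1 ≤ x → x ≤ at μ y → InD μ y x
  inD {y} 1≤y 1≤x x≤μy = 1≤y , row-exists y (≤-trans 1≤x x≤μy) , 1≤x , x≤μy

  -- all sums over cells run over the n × n square, cutting out D_μ by this indicator
  cell? : ℕ → ℕ → Bool
  cell? y x = x ≤ᵇ at μ y

  fiberSize≡∑² : ∀ v → fiberSize T μ v ≡ ∑ n (λ y → ∑ n (λ x → 𝟙 (cell? y x) * 𝟙 (T y x ≡ᵇ v)))
  fiberSize≡∑² v = begin
    fiberSize T μ v
      ≡⟨ fiberSize≡∑ T μ v ⟩
    ∑ (length μ) (λ y → ∑ (at μ y) (λ x → 𝟙 (T y x ≡ᵇ v)))
      ≡⟨ ∑-cong (length μ) (λ y _ _ → sym (∑-restrict n (at μ y) _ (at-μ≤n y))) ⟩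
    ∑ (length μ) (λ y → ∑ n (λ x → 𝟙 (cell? y x) * 𝟙 (T y x ≡ᵇ v)))
      ≡⟨ ∑-vanishing-tail _ length-μ≤n (λ y len<y _ → trans (∑-restrict n (at μ y) _ (at-μ≤n y))
                                          (cong (λ z → ∑ z (λ x → 𝟙 (T y x ≡ᵇ v))) (at-beyond-length μ y len<y))) ⟨
    ∑ n (λ y → ∑ n (λ x → 𝟙 (cell? y x) * 𝟙 (T y x ≡ᵇ v))) ∎
    where open ≡-Reasoning

  module Column (M V : ℕ → Bool) (M⊆V : ∀ v → 1 ≤ v → v ≤ h → M v ≡ true → V v ≡ true)
                (V-down : ∀ u v → 1 ≤ u → u ≤ v → V v ≡ true → V u ≡ true)
                (x : ℕ) (1≤x : 1 ≤ x) where

    cell-down : ∀ y → 1 ≤ y → cell? (suc y) x ≡ true → cell? y x ≡ true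
    cell-down y 1≤y e = ≤⇒≤ᵇ≡true (≤-trans (≤ᵇ≡true⇒≤ {x} e) (at-antitone μ μ-nonIncreasing y 1≤y))

    #M : ℕ → ℕ
    #M z = ∑ z (λ v → 𝟙 (M v))

    M-entry : ℕ → ℕ
    M-entry y = 𝟙 (cell? y x) * 𝟙 (M (T y x))

    V-entry : ℕ → Bool
    V-entry y = cell? y x ∧ V (T y x)

    -- Column strictness: the M-valued entries in rows 1..Y carry distinct M-values ≤ T(Y,x).
    M-entries≤ : ∀ Y → ∑ Y M-entry ≤ #M h × (1 ≤ Y → cell? Y x ≡ true → ∑ Y M-entry ≤ #M (T Y x))
    M-entries-above≤ : ∀ Y → cell? (suc Y) x ≡ true → ∑ Y M-entry ≤ #M (T (suc Y) x ∸ 1)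

    M-entries-above≤ zero     _ = z≤n
    M-entries-above≤ (suc Y) e =
      ≤-trans (proj₂ (M-entries≤ (suc Y)) (s≤s z≤n) e′)
              (∑-mono-range _ (<⇒≤pred (T-column-strict (suc Y) x (inD (s≤s z≤n) 1≤x (≤ᵇ≡true⇒≤ e′))
                                                                   (inD (s≤s z≤n) 1≤x (≤ᵇ≡true⇒≤ e)))))
      where
      e′ = cell-down (suc Y) (s≤s z≤n) e

    M-entries≤ zero = z≤n , λ ()
    M-entries≤ (suc Y) with cell? (suc Y) x in e
    ... | false = ≤-trans (≤-reflexive (+-identityʳ (∑ Y M-entry))) (proj₁ (M-entries≤ Y)) , λ _ ()
    ... | true  = ≤-trans bound (∑-mono-range _ (proj₂ range)) , λ _ _ → bound
      where
      range : 1 ≤ T (suc Y) x × T (suc Y) x ≤ h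
      range = T-range (suc Y) x (inD (s≤s z≤n) 1≤x (≤ᵇ≡true⇒≤ e))
      #M-step : ∀ z → 1 ≤ z → #M (z ∸ 1) + 𝟙 (M z) ≡ #M z
      #M-step (suc z) _ = refl
      bound : ∑ Y M-entry + 𝟙 true * 𝟙 (M (T (suc Y) x)) ≤ #M (T (suc Y) x)
      bound = ≤-trans (+-mono-≤ (M-entries-above≤ Y e) (≤-reflexive (+-identityʳ _)))
                      (≤-reflexive (#M-step (T (suc Y) x) (proj₁ range)))

    M-entry≤V-entry : ∀ y → 1 ≤ y → M-entry y ≤ 𝟙 (V-entry y)
    M-entry≤V-entry y 1≤y with cell? y x in e | M (T y x) in eM
    ... | false | _     = z≤n
    ... | true  | false = z≤n
    ... | true  | true with T-range y x (inD 1≤y 1≤x (≤ᵇ≡true⇒≤ e))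
    ...   | 1≤T , T≤h rewrite M⊆V (T y x) 1≤T T≤h eM = ≤-refl

    V-entry-down : ∀ y → 1 ≤ y → V-entry (suc y) ≡ true → V-entry y ≡ true
    V-entry-down y 1≤y e with cell? (suc y) x in e₁ | V (T (suc y) x) in e₂
    V-entry-down y 1≤y () | false | _
    V-entry-down y 1≤y () | true  | false
    ... | true | true with cell-down y 1≤y e₁
    ...   | e₃ rewrite e₃ = V-down (T y x) (T (suc y) x) (proj₁ (T-range y x (inD 1≤y 1≤x (≤ᵇ≡true⇒≤ e₃))))
                                 (<⇒≤ (T-column-strict y x (inD 1≤y 1≤x (≤ᵇ≡true⇒≤ e₃))
                                                           (inD (s≤s z≤n) 1≤x (≤ᵇ≡true⇒≤ e₁)))) e₂

    column-bound : ∀ j → #M h ≤ j → ∑ n M-entry ≤ ∑ j (λ y → 𝟙 (V-entry y))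
    column-bound j #M≤j with DownClosed.∑-dichotomy V-entry V-entry-down n j
    ... | inj₁ inside   = ≤-trans (∑-mono n (λ y 1≤y _ → M-entry≤V-entry y 1≤y)) inside
    ... | inj₂ contains = ≤-trans (proj₁ (M-entries≤ n)) (≤-trans #M≤j contains)

  ∑-values-at-cell : ∀ (M : ℕ → Bool) y x → 1 ≤ y → 1 ≤ x →
    ∑ h (λ v → 𝟙 (M v) * (𝟙 (cell? y x) * 𝟙 (T y x ≡ᵇ v))) ≡ 𝟙 (cell? y x) * 𝟙 (M (T y x))
  ∑-values-at-cell M y x 1≤y 1≤x with cell? y x in e
  ... | false = ∑-zero h (λ v _ _ → *-zeroʳ (𝟙 (M v)))
  ... | true with T-range y x (inD 1≤y 1≤x (≤ᵇ≡true⇒≤ e))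
  ...   | 1≤T , T≤h =
    trans (∑-cong h (λ v _ _ → trans (cong (𝟙 (M v) *_) (+-identityʳ _)) (*-comm (𝟙 (M v)) (𝟙 (T y x ≡ᵇ v)))))
          (trans (∑-δ-* h (T y x) (λ v → 𝟙 (M v)) 1≤T T≤h) (sym (+-identityʳ _)))

  -- The cells carrying a value of M (at most j values) can be moved into the first j rows,
  -- each into a cell whose value lies in V.
  ∑-mask-content≤ : (M V : ℕ → Bool) → (∀ v → 1 ≤ v → v ≤ h → M v ≡ true → V v ≡ true)
    → (∀ u v → 1 ≤ u → u ≤ v → V v ≡ true → V u ≡ true)
    → ∀ j → ∑ h (λ v → 𝟙 (M v)) ≤ j
    → ∑ h (λ v → 𝟙 (M v) * at a v) ≤ ∑ j (λ y → ∑ n (λ x → 𝟙 (cell? y x ∧ V (T y x))))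
  ∑-mask-content≤ M V M⊆V V-down j #M≤j = begin
    ∑ h (λ v → 𝟙 (M v) * at a v)
      ≡⟨ ∑-cong h (λ v p q → cong (𝟙 (M v) *_) (trans (sym (T-content v p q)) (fiberSize≡∑² v))) ⟩
    ∑ h (λ v → 𝟙 (M v) * ∑ n (λ y → ∑ n (λ x → 𝟙 (cell? y x) * 𝟙 (T y x ≡ᵇ v))))
      ≡⟨ ∑-cong h (λ v _ _ → trans (∑-*ˡ n (𝟙 (M v)) _) (∑-cong n (λ y _ _ → ∑-*ˡ n (𝟙 (M v)) _))) ⟩
    ∑ h (λ v → ∑ n (λ y → ∑ n (λ x → 𝟙 (M v) * (𝟙 (cell? y x) * 𝟙 (T y x ≡ᵇ v)))))
      ≡⟨ ∑-comm h n _ ⟩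
    ∑ n (λ y → ∑ h (λ v → ∑ n (λ x → 𝟙 (M v) * (𝟙 (cell? y x) * 𝟙 (T y x ≡ᵇ v)))))
      ≡⟨ ∑-cong n (λ y _ _ → ∑-comm h n _) ⟩
    ∑ n (λ y → ∑ n (λ x → ∑ h (λ v → 𝟙 (M v) * (𝟙 (cell? y x) * 𝟙 (T y x ≡ᵇ v)))))
      ≡⟨ ∑-cong n (λ y p _ → ∑-cong n (λ x q _ → ∑-values-at-cell M y x p q)) ⟩
    ∑ n (λ y → ∑ n (λ x → 𝟙 (cell? y x) * 𝟙 (M (T y x))))
      ≡⟨ ∑-comm n n _ ⟩
    ∑ n (λ x → ∑ n (λ y → 𝟙 (cell? y x) * 𝟙 (M (T y x))))
      ≤⟨ ∑-mono n (λ x 1≤x _ → Column.column-bound M V M⊆V V-down x 1≤x j #M≤j) ⟩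
    ∑ n (λ x → ∑ j (λ y → 𝟙 (cell? y x ∧ V (T y x))))
      ≡⟨ ∑-comm j n _ ⟨
    ∑ j (λ y → ∑ n (λ x → 𝟙 (cell? y x ∧ V (T y x)))) ∎
    where open ≤-Reasoning

module LastValueCells (n : ℕ) (μ a : List ℕ) (hμ : IsPartition n μ) (T : ℕ → ℕ → ℕ) (hT : IsSTab μ a T)
                      (ts : List (ℕ × ℕ)) (length-ts : length ts ≡ lastPart a)
                      (ts-spec : ∀ i j → ((i , j) ∈ ts) ⇔ (InD μ i j × T i j ≡ length a))
                      (1≤c : 1 ≤ lastPart a) where

  open Tableau n μ a hμ T hT public

  rows : List ℕ
  rows = map proj₁ ts

  h-cell : ℕ → ℕ → ℕ
  h-cell y x = 𝟙 (cell? y x) * 𝟙 (T y x ≡ᵇ h)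

  1≤h : 1 ≤ h
  1≤h = lastPart-positive⇒nonEmpty a 1≤c

  ts-inD : ∀ {p} → p ∈ ts → InD μ (proj₁ p) (proj₂ p)
  ts-inD {y , x} p∈ = proj₁ (Equivalence.to (ts-spec y x) p∈)

  ts-in-square : All (λ p → (1 ≤ proj₁ p × proj₁ p ≤ n) × (1 ≤ proj₂ p × proj₂ p ≤ n)) ts
  ts-in-square = All.tabulate λ p∈ → let (1≤y , y≤len , 1≤x , x≤μy) = ts-inD p∈ in
    (1≤y , ≤-trans y≤len length-μ≤n) , (1≤x , ≤-trans x≤μy (at-μ≤n _))

  rows-in-range : All (λ k → 1 ≤ k × k ≤ n) rows
  rows-in-range = All.tabulate λ k∈ → let (p , p∈ , k≡) = ∈-map⁻ proj₁ k∈ in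
    subst (λ z → 1 ≤ z × z ≤ n) (sym k≡) (proj₁ (All.lookup ts-in-square p∈))

  occurrences : List (ℕ × ℕ) → ℕ → ℕ → ℕ
  occurrences []      y x = 0
  occurrences (p ∷ L) y x = 𝟙 (proj₁ p ≡ᵇ y) * 𝟙 (proj₂ p ≡ᵇ x) + occurrences L y x

  ∈⇒1≤occurrences : ∀ L {y x} → (y , x) ∈ L → 1 ≤ occurrences L y x
  ∈⇒1≤occurrences (p ∷ L) {y} {x} (here refl) rewrite ≡ᵇ-refl y | ≡ᵇ-refl x = s≤s z≤n
  ∈⇒1≤occurrences (p ∷ L)         (there p∈)  = ≤-trans (∈⇒1≤occurrences L p∈) (m≤n+m _ _)

  ∑²-occurrences≤length : ∀ L → ∑ n (λ y → ∑ n (occurrences L y)) ≤ length L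
  ∑²-occurrences≤length []              =
    ≤-reflexive (trans (∑-cong n (λ _ _ _ → ∑-zero n (λ _ _ _ → refl))) (∑-zero n (λ _ _ _ → refl)))
  ∑²-occurrences≤length ((p₁ , p₂) ∷ L) = begin
    ∑ n (λ y → ∑ n (λ x → δ y x + occurrences L y x))
      ≡⟨ ∑-cong n (λ y _ _ → ∑-distrib-+ n _ _) ⟩
    ∑ n (λ y → ∑ n (δ y) + ∑ n (occurrences L y))
      ≡⟨ ∑-distrib-+ n _ _ ⟩
    ∑ n (λ y → ∑ n (δ y)) + ∑ n (λ y → ∑ n (occurrences L y))
      ≤⟨ +-mono-≤ single (∑²-occurrences≤length L) ⟩
    suc (length L) ∎
    where
    open ≤-Reasoning
    δ : ℕ → ℕ → ℕ
    δ y x = 𝟙 (p₁ ≡ᵇ y) * 𝟙 (p₂ ≡ᵇ x)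
    single : ∑ n (λ y → ∑ n (δ y)) ≤ 1
    single = begin
      ∑ n (λ y → ∑ n (δ y))                    ≡⟨ ∑-cong n (λ y _ _ → ∑-*ˡ n (𝟙 (p₁ ≡ᵇ y)) _) ⟨
      ∑ n (λ y → 𝟙 (p₁ ≡ᵇ y) * ∑ n (λ x → 𝟙 (p₂ ≡ᵇ x)))
                                               ≤⟨ ∑-mono n (λ y _ _ → *-monoʳ-≤ (𝟙 (p₁ ≡ᵇ y)) (∑-δ≤1 n p₂)) ⟩
      ∑ n (λ y → 𝟙 (p₁ ≡ᵇ y) * 1)              ≡⟨ ∑-cong n (λ y _ _ → *-identityʳ _) ⟩
      ∑ n (λ y → 𝟙 (p₁ ≡ᵇ y))                  ≤⟨ ∑-δ≤1 n p₁ ⟩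
      1                                        ∎

  h-cell≤occurrences : ∀ y x → 1 ≤ y → 1 ≤ x → h-cell y x ≤ occurrences ts y x
  h-cell≤occurrences y x 1≤y 1≤x with cell? y x in e | T y x ≡ᵇ h in e′
  ... | false | _     = z≤n
  ... | true  | false = z≤n
  ... | true  | true  =
    ∈⇒1≤occurrences ts (Equivalence.from (ts-spec y x) (inD 1≤y 1≤x (≤ᵇ≡true⇒≤ e) , ≡ᵇ≡true⇒≡ e′))

  ∑²-h-cell : ∑ n (λ y → ∑ n (h-cell y)) ≡ length ts
  ∑²-h-cell = trans (sym (fiberSize≡∑² h)) (trans (T-content h 1≤h ≤-refl) (trans (at-last a 1≤h) (sym length-ts)))
    where
    at-last : ∀ (L : List ℕ) → 1 ≤ length L → at L (length L) ≡ lastPart L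
    at-last (x ∷ [])     _ = refl
    at-last (x ∷ y ∷ ys) _ = at-last (y ∷ ys) (s≤s z≤n)

  -- Since ts has exactly as many entries as there are h-cells, it lists each of them exactly once.
  occurrences≡h-cell : ∀ y x → 1 ≤ y → y ≤ n → 1 ≤ x → x ≤ n → occurrences ts y x ≡ h-cell y x
  occurrences≡h-cell y x 1≤y y≤n 1≤x x≤n =
    pointwise-≡-of-∑-≤ n (≤-reflexive row≡) (λ x′ 1≤x′ _ → h-cell≤occurrences y x′ 1≤y 1≤x′) x 1≤x x≤n
    where
    row≡ : ∑ n (occurrences ts y) ≡ ∑ n (h-cell y)
    row≡ = pointwise-≡-of-∑-≤ n (≤-trans (∑²-occurrences≤length ts) (≤-reflexive (sym ∑²-h-cell)))
             (λ y′ 1≤y′ _ → ∑-mono n (λ x′ 1≤x′ _ → h-cell≤occurrences y′ x′ 1≤y′ 1≤x′)) y 1≤y y≤n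

  count≡∑-occurrences : ∀ L → All (λ p → 1 ≤ proj₂ p × proj₂ p ≤ n) L
                      → ∀ y → count (map proj₁ L) y ≡ ∑ n (occurrences L y)
  count≡∑-occurrences []              []                 y = sym (∑-zero n (λ _ _ _ → refl))
  count≡∑-occurrences ((p₁ , p₂) ∷ L) ((1≤p₂ , p₂≤n) ∷ ps) y = sym (begin
    ∑ n (λ x → 𝟙 (p₁ ≡ᵇ y) * 𝟙 (p₂ ≡ᵇ x) + occurrences L y x)
      ≡⟨ ∑-distrib-+ n _ _ ⟩
    ∑ n (λ x → 𝟙 (p₁ ≡ᵇ y) * 𝟙 (p₂ ≡ᵇ x)) + ∑ n (occurrences L y)
      ≡⟨ cong₂ _+_ (sym (∑-*ˡ n (𝟙 (p₁ ≡ᵇ y)) _)) (sym (count≡∑-occurrences L ps y)) ⟩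
    𝟙 (p₁ ≡ᵇ y) * ∑ n (λ x → 𝟙 (p₂ ≡ᵇ x)) + count (map proj₁ L) y
      ≡⟨ cong (λ z → 𝟙 (p₁ ≡ᵇ y) * z + count (map proj₁ L) y) (∑-δ n p₂ 1≤p₂ p₂≤n) ⟩
    𝟙 (p₁ ≡ᵇ y) * 1 + count (map proj₁ L) y
      ≡⟨ cong (_+ count (map proj₁ L) y) (*-identityʳ _) ⟩
    count (map proj₁ ((p₁ , p₂) ∷ L)) y ∎)
    where open ≡-Reasoning

  count-rows : ∀ y → 1 ≤ y → count rows y ≡ ∑ n (h-cell y)
  count-rows y 1≤y with y ≤? n
  ... | yes y≤n = trans (count≡∑-occurrences ts (All.map proj₂ ts-in-square) y)
                        (∑-cong n λ x 1≤x x≤n → occurrences≡h-cell y x 1≤y y≤n 1≤x x≤n)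
  ... | no  y≰n = trans (count-beyond rows y (All.map (λ (_ , k≤n) → ≤-<-trans k≤n (≰⇒> y≰n)) rows-in-range))
                        (sym (∑-zero n no-cell))
    where
    no-cell : ∀ x → 1 ≤ x → x ≤ n → h-cell y x ≡ 0
    no-cell x 1≤x _ rewrite at-beyond-length μ y (≤-<-trans length-μ≤n (≰⇒> y≰n))
                          | >⇒≤ᵇ≡false {x} {0} 1≤x = refl

  -- The h-cells of row y lie strictly to the right of row y+1, by column strictness.
  count-rows+at-μ≤ : ∀ y → 1 ≤ y → count rows y + at μ (suc y) ≤ at μ y
  count-rows+at-μ≤ y 1≤y = begin
    count rows y + at μ (suc y)
      ≡⟨ cong₂ _+_ (count-rows y 1≤y) (sym (∑-𝟙≤ n (at μ (suc y)) (at-μ≤n _))) ⟩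
    ∑ n (h-cell y) + ∑ n (λ x → 𝟙 (x ≤ᵇ at μ (suc y)))
      ≡⟨ ∑-distrib-+ n _ _ ⟨
    ∑ n (λ x → h-cell y x + 𝟙 (x ≤ᵇ at μ (suc y)))
      ≤⟨ ∑-mono n (λ x 1≤x _ → disjoint x 1≤x) ⟩
    ∑ n (λ x → 𝟙 (x ≤ᵇ at μ y))
      ≡⟨ ∑-𝟙≤ n (at μ y) (at-μ≤n _) ⟩
    at μ y ∎
    where
    open ≤-Reasoning
    disjoint : ∀ x → 1 ≤ x → h-cell y x + 𝟙 (x ≤ᵇ at μ (suc y)) ≤ 𝟙 (x ≤ᵇ at μ y)
    disjoint x 1≤x with x ≤ᵇ at μ y in e₁ | T y x ≡ᵇ h in e₂
    ... | false | _ rewrite >⇒≤ᵇ≡false {x} {at μ (suc y)}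
                              (≤-trans (s≤s (at-antitone μ μ-nonIncreasing y 1≤y)) (≤ᵇ≡false⇒> e₁)) = z≤n
    ... | true  | false = 𝟙≤1 _
    ... | true  | true with x ≤ᵇ at μ (suc y) in e₃
    ...   | false = ≤-refl
    ...   | true  = ⊥-elim (<⇒≱ (T-column-strict y x below above)
                                (≤-trans (proj₂ (T-range (suc y) x above)) (≤-reflexive (sym (≡ᵇ≡true⇒≡ e₂)))))
      where
      below = inD 1≤y 1≤x (≤ᵇ≡true⇒≤ e₁)
      above = inD (s≤s z≤n) 1≤x (≤ᵇ≡true⇒≤ e₃)

  row-length : ∀ y → ∑ n (λ x → 𝟙 (cell? y x ∧ true)) ≡ at μ y
  row-length y = trans (∑-cong n (λ x _ _ → cong 𝟙 (∧-identityʳ (cell? y x)))) (∑-𝟙≤ n (at μ y) (at-μ≤n y))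

  below-h : ℕ → Bool
  below-h v = suc v ≤ᵇ h

  row-split : ∀ y → 1 ≤ y → ∑ n (λ x → 𝟙 (cell? y x ∧ below-h (T y x))) + ∑ n (h-cell y) ≡ at μ y
  row-split y 1≤y =
    trans (sym (∑-distrib-+ n _ _)) (trans (∑-cong n (λ x 1≤x _ → split x 1≤x)) (∑-𝟙≤ n (at μ y) (at-μ≤n y)))
    where
    split : ∀ x → 1 ≤ x → 𝟙 (cell? y x ∧ below-h (T y x)) + h-cell y x ≡ 𝟙 (cell? y x)
    split x 1≤x with cell? y x in e
    ... | false = refl
    ... | true with T-range y x (inD 1≤y 1≤x (≤ᵇ≡true⇒≤ e)) | T y x ≡ᵇ h in e′
    ...   | _ , _   | true rewrite ≡ᵇ≡true⇒≡ {T y x} {h} e′ | >⇒≤ᵇ≡false {suc h} {h} ≤-refl = refl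
    ...   | _ , T≤h | false rewrite ≤⇒≤ᵇ≡true {suc (T y x)} {h} (≤∧≢⇒< T≤h (≡ᵇ≡false⇒≢ e′)) = refl

  h-cells-in-first-rows : ∀ i j → suc i ≤ lastPart a → All (λ k → 1 ≤ k × k ≤ j) (take (suc i) rows)
                        → suc i ≤ ∑ j (λ y → ∑ n (h-cell y))
  h-cells-in-first-rows i j i<c take-in-range = begin
    suc i                       ≡⟨ length-take-rows ⟨
    length (take (suc i) rows)  ≡⟨ ∑-count j _ take-in-range ⟨
    ∑ j (count (take (suc i) rows))  ≤⟨ ∑-mono j (λ y _ _ → count-take (suc i) rows y) ⟩
    ∑ j (count rows)            ≡⟨ ∑-cong j (λ y 1≤y _ → count-rows y 1≤y) ⟩
    ∑ j (λ y → ∑ n (h-cell y))  ∎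
    where
    open ≤-Reasoning
    length-take-rows : length (take (suc i) rows) ≡ suc i
    length-take-rows = trans (length-take (suc i) rows)
                             (m≤n⇒m⊓n≡m (≤-trans i<c (≤-reflexive (sym (trans (length-map proj₁ ts) length-ts)))))

  ∑-mask-content-tilde^ : ∀ k → k ≤ lastPart a → (M : ℕ → Bool)
    → ∑ h (λ v → 𝟙 (M v) * at a v) ≡ ∑ h (λ v → 𝟙 (M v) * at (tilde^ k a) v) + 𝟙 (M h) * k
  ∑-mask-content-tilde^ k k≤c M = begin
    ∑ h (λ v → 𝟙 (M v) * at a v)
      ≡⟨ ∑-cong h (λ v _ _ → cong (𝟙 (M v) *_) (sym (Iterates.at-tilde^ a k k≤c v))) ⟩
    ∑ h (λ v → 𝟙 (M v) * (at x v + 𝟙 (h ≡ᵇ v) * k))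
      ≡⟨ ∑-cong h (λ v _ _ → trans (*-distribˡ-+ (𝟙 (M v)) _ _)
                                  (cong (𝟙 (M v) * at x v +_) (exchange (𝟙 (M v)) (𝟙 (h ≡ᵇ v)) k))) ⟩
    ∑ h (λ v → 𝟙 (M v) * at x v + 𝟙 (h ≡ᵇ v) * (𝟙 (M v) * k))
      ≡⟨ ∑-distrib-+ h _ _ ⟩
    ∑ h (λ v → 𝟙 (M v) * at x v) + ∑ h (λ v → 𝟙 (h ≡ᵇ v) * (𝟙 (M v) * k))
      ≡⟨ cong (∑ h (λ v → 𝟙 (M v) * at x v) +_) (∑-δ-* h h (λ v → 𝟙 (M v) * k) 1≤h ≤-refl) ⟩
    ∑ h (λ v → 𝟙 (M v) * at x v) + 𝟙 (M h) * k ∎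
    where
    open ≡-Reasoning
    x = tilde^ k a
    exchange : ∀ p q r → p * (q * r) ≡ q * (p * r)
    exchange = solve-∀

  -- The j largest parts of a^{i+1} are the contents of a set M of at most j values. If h ∈ M its cells fit
  -- into the first j rows; if not, they fit there among the cells of value < h, next to the i+1 h-cells.
  psum-lam-tilde^+≤ : ∀ i j → suc i ≤ lastPart a → All (λ k → 1 ≤ k × k ≤ j) (take (suc i) rows)
                    → psum (lam (tilde^ (suc i) a)) j + suc i ≤ psum μ j
  psum-lam-tilde^+≤ i j i<c take-in-range
    with lam-psum-selection-within (tilde^ (suc i) a) j h (length-tilde^≤ (suc i) a)
  ... | M , size , value with M h in e
  ... | true = begin
      psum (lam x) j + suc i                    ≤⟨ +-monoˡ-≤ (suc i) value ⟩
      ∑ h (λ v → 𝟙 (M v) * at x v) + suc i      ≡⟨ cong (∑ h (λ v → 𝟙 (M v) * at x v) +_) (sym (*-identityˡ (suc i))) ⟩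
      ∑ h (λ v → 𝟙 (M v) * at x v) + 𝟙 true * suc i  ≡⟨ trans (cong (λ b → K + 𝟙 b * suc i) (sym e)) (sym content) ⟩
      ∑ h (λ v → 𝟙 (M v) * at a v)              ≤⟨ ∑-mask-content≤ M (λ _ → true) (λ _ _ _ _ → refl) (λ _ _ _ _ _ → refl) j size ⟩
      ∑ j (λ y → ∑ n (λ x → 𝟙 (cell? y x ∧ true)))  ≡⟨ ∑-cong j (λ y _ _ → row-length y) ⟩
      ∑ j (at μ)                                ≡⟨ psum≡∑ μ j ⟨
      psum μ j                                  ∎
    where
    open ≤-Reasoning
    x = tilde^ (suc i) a
    K = ∑ h (λ v → 𝟙 (M v) * at x v)
    content = ∑-mask-content-tilde^ (suc i) i<c M
  ... | false = begin
      psum (lam x) j + suc i                    ≤⟨ +-monoˡ-≤ (suc i) value ⟩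
      ∑ h (λ v → 𝟙 (M v) * at x v) + suc i      ≡⟨ cong (_+ suc i) (trans (sym (+-identityʳ _))
                                                      (trans (cong (λ b → K + 𝟙 b * suc i) (sym e)) (sym content))) ⟩
      ∑ h (λ v → 𝟙 (M v) * at a v) + suc i      ≤⟨ +-mono-≤ (∑-mask-content≤ M below-h M⊆below-h below-h-down j size)
                                                              (h-cells-in-first-rows i j i<c take-in-range) ⟩
      ∑ j (λ y → ∑ n (λ x → 𝟙 (cell? y x ∧ below-h (T y x)))) + ∑ j (λ y → ∑ n (h-cell y))
                                                ≡⟨ ∑-distrib-+ j _ _ ⟨
      ∑ j (λ y → ∑ n (λ x → 𝟙 (cell? y x ∧ below-h (T y x))) + ∑ n (h-cell y))
                                                ≡⟨ ∑-cong j (λ y 1≤y _ → row-split y 1≤y) ⟩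
      ∑ j (at μ)                                ≡⟨ psum≡∑ μ j ⟨
      psum μ j                                  ∎
    where
    open ≤-Reasoning
    x = tilde^ (suc i) a
    K = ∑ h (λ v → 𝟙 (M v) * at x v)
    content = ∑-mask-content-tilde^ (suc i) i<c M
    M⊆below-h : ∀ v → 1 ≤ v → v ≤ h → M v ≡ true → below-h v ≡ true
    M⊆below-h v _ v≤h eM = ≤⇒≤ᵇ≡true (≤∧≢⇒< v≤h (λ { refl → case (trans (sym eM) e) }))
      where case : true ≡ false → ⊥
            case ()
    below-h-down : ∀ u v → 1 ≤ u → u ≤ v → below-h v ≡ true → below-h u ≡ true
    below-h-down u v _ u≤v e′ = ≤⇒≤ᵇ≡true (≤-trans (s≤s u≤v) (≤ᵇ≡true⇒≤ {suc v} {h} e′))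

module Construction (n : ℕ) (μ a : List ℕ) (hμ : IsPartition n μ) (ha : IsComposition n a)
                    (hD : Dom μ (lam a)) (r : ℕ) (hR : InR μ a r)
                    (T : ℕ → ℕ → ℕ) (hT : IsSTab μ a T)
                    (ts : List (ℕ × ℕ)) (length-ts : length ts ≡ lastPart a)
                    (ts-spec : ∀ i j → ((i , j) ∈ ts) ⇔ (InD μ i j × T i j ≡ length a))
                    (ts-sorted : Linked _≤_ (r ∷ map proj₁ ts)) where

  1≤r : 1 ≤ r
  1≤r = proj₁ hR

  1≤length-a : 1 ≤ length a
  1≤length-a = nonEmpty a (proj₂ ha)
    where
    1≤n : 1 ≤ n
    1≤n = ≤-trans 1≤r (≤-trans (proj₁ (proj₂ hR))
                               (subst (length μ ≤_) (proj₂ (proj₁ hμ)) (length≤sum μ (proj₁ (proj₁ hμ)))))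
    nonEmpty : ∀ b → sum b ≡ n → 1 ≤ length b
    nonEmpty []      n≡0 = ⊥-elim (<⇒≱ 1≤n (≤-reflexive (sym n≡0)))
    nonEmpty (_ ∷ _) _   = s≤s z≤n

  c : ℕ
  c = lastPart a

  1≤c : 1 ≤ c
  1≤c = lastPart-positive a (proj₁ ha) 1≤length-a

  open LastValueCells n μ a hμ T hT ts length-ts ts-spec 1≤c

  length-rows : length rows ≡ c
  length-rows = trans (length-map proj₁ ts) length-ts

  -- t i is the row of the i-th cell of value h, with t 0 = r
  t : ℕ → ℕ
  t i = at (r ∷ rows) (suc i)

  sum-after-removal : ∀ ν ks → LastPositive ν → (∀ y → 1 ≤ y → at ν y + count ks y ≡ at μ y)
                    → All (λ k → 1 ≤ k × k ≤ n) ks → sum ν + length ks ≡ n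
  sum-after-removal ν ks ν-pos removed ks-in-range = begin
      sum ν + length ks             ≡⟨ cong₂ _+_ (sym (psum-all ν n length-ν≤n)) (sym (∑-count n ks ks-in-range)) ⟩
      psum ν n + ∑ n (count ks)     ≡⟨ psum-+∑count μ ν ks removed n ⟩
      psum μ n                      ≡⟨ psum-all μ n length-μ≤n ⟩
      sum μ                         ≡⟨ sum-μ ⟩
      n                             ∎
    where
    open ≡-Reasoning
    length-ν≤n : length ν ≤ n
    length-ν≤n = lastPositive-length≤ ν n ν-pos (λ y n<y → n≤0⇒n≡0 (≤-trans (m≤m+n (at ν y) (count ks y))
      (≤-reflexive (trans (removed y (≤-trans (s≤s z≤n) n<y)) (at-beyond-length μ y (≤-<-trans length-μ≤n n<y))))))

  -- The state after i steps: ρ = μ^i, l = l_i, and ls = (l_1, …, l_i) are the rows removed so far.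
  record Invariant (i : ℕ) : Set where
    field
      ρ          : List ℕ
      l          : ℕ
      ls         : List ℕ
      sequence   : seqAlμ a μ r i ≡ just (tilde^ i a , l , ρ)
      removed    : ∀ y → 1 ≤ y → at ρ y + count ls y ≡ at μ y
      ls≤rows    : Pointwise _≤_ ls (take i rows)
      ls-positive : All (1 ≤_) ls
      length-ls  : length ls ≡ i
      l≤t        : l ≤ t i
      ρ-lastPositive : LastPositive ρ
      dominates  : ∀ j → psum (lam (tilde^ i a)) j ≤ psum ρ j

  invariant₀ : Invariant 0
  invariant₀ = record
    { ρ = μ ; l = r ; ls = [] ; sequence = refl
    ; removed = λ y _ → +-identityʳ (at μ y)
    ; ls≤rows = [] ; ls-positive = [] ; length-ls = refl ; l≤t = ≤-refl
    ; ρ-lastPositive = allPositive⇒lastPositive μ μ-positive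
    ; dominates = dom⇒psum≤ μ (lam a) (≤-reflexive (trans (sum-lam a) (trans (proj₂ ha) (sym sum-μ)))) hD }

  module Step (i : ℕ) (i<c : i < c) (I : Invariant i) where
    open Invariant I

    i<length-rows : i < length rows
    i<length-rows = subst (i <_) (sym length-rows) i<c

    next : ℕ
    next = t (suc i)

    next-in-range : 1 ≤ next × next ≤ n
    next-in-range = All.lookup rows-in-range (at-∈ rows i i<length-rows)

    1≤next : 1 ≤ next
    1≤next = proj₁ next-in-range

    t≤next : t i ≤ next
    t≤next = at-linked-≤ r rows ts-sorted i i<length-rows

    take-rows≤next : All (_≤ next) (take i rows)
    take-rows≤next = All.map (λ (_ , k≤) → ≤-trans k≤ t≤next) (take-linked-bounds r rows ts-sorted i (<⇒≤ i<length-rows))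

    ls≤next : All (_≤ next) ls
    ls≤next = pointwise-≤-bound ls≤rows take-rows≤next

    ls-in-range : All (λ k → 1 ≤ k × k ≤ n) ls
    ls-in-range = All.zip (ls-positive , All.map (λ k≤ → ≤-trans k≤ (proj₂ next-in-range)) ls≤next)

    take-suc-rows : take (suc i) rows ≡ take i rows ∷ʳ next
    take-suc-rows = take-suc-∷ʳ rows i i<length-rows

    count-ls<count-rows : 1 + count ls next ≤ count rows next
    count-ls<count-rows = begin
      1 + count ls next                        ≤⟨ +-monoʳ-≤ 1 (count-max-mono ls≤rows take-rows≤next) ⟩
      1 + count (take i rows) next             ≡⟨ +-comm 1 _ ⟩
      count (take i rows) next + 1             ≡⟨ cong (λ b → count (take i rows) next + 𝟙 b) (sym (≡ᵇ-refl next)) ⟩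
      count (take i rows) next + 𝟙 (next ≡ᵇ next)  ≡⟨ trans (cong (λ L → count L next) take-suc-rows) (count-∷ʳ (take i rows) next next) ⟨
      count (take (suc i) rows) next           ≤⟨ count-take (suc i) rows next ⟩
      count rows next                          ∎
      where open ≤-Reasoning

    -- Row next of ρ still contains an h-cell, which sits at the end of the row.
    corner : at ρ (suc next) < at ρ next
    corner = +-cancelʳ-≤ (count ls next) (suc (at ρ (suc next))) (at ρ next) (begin
      suc (at ρ (suc next)) + count ls next    ≡⟨ cong (λ z → suc z + count ls next) below-unchanged ⟩
      suc (at μ (suc next)) + count ls next    ≡⟨ +-suc (at μ (suc next)) (count ls next) ⟨
      at μ (suc next) + (1 + count ls next)    ≤⟨ +-monoʳ-≤ (at μ (suc next)) count-ls<count-rows ⟩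
      at μ (suc next) + count rows next        ≡⟨ +-comm (at μ (suc next)) (count rows next) ⟩
      count rows next + at μ (suc next)        ≤⟨ count-rows+at-μ≤ next 1≤next ⟩
      at μ next                                ≡⟨ removed next 1≤next ⟨
      at ρ next + count ls next                ∎)
      where
      open ≤-Reasoning
      below-unchanged : at ρ (suc next) ≡ at μ (suc next)
      below-unchanged = trans (sym (+-identityʳ _))
        (trans (cong (at ρ (suc next) +_) (sym (count-beyond ls (suc next) (All.map s≤s ls≤next)))) (removed (suc next) (s≤s z≤n)))

    next≤length-ρ : next ≤ length ρ
    next≤length-ρ with next ≤? length ρ
    ... | yes next≤ = next≤
    ... | no  next≰ = ⊥-elim (n≮0 (subst (at ρ (suc next) <_) (at-beyond-length ρ next (≰⇒> next≰)) corner))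

    1≤ρ-next : 1 ≤ at ρ next
    1≤ρ-next = ≤-trans (s≤s z≤n) corner

    removed-decAt : ∀ k → 1 ≤ k → 1 ≤ at ρ k → ∀ y → 1 ≤ y → at (decAt ρ k) y + count (ls ∷ʳ k) y ≡ at μ y
    removed-decAt k 1≤k 1≤ρk y 1≤y = begin
      at (decAt ρ k) y + count (ls ∷ʳ k) y             ≡⟨ cong (at (decAt ρ k) y +_) (count-∷ʳ ls k y) ⟩
      at (decAt ρ k) y + (count ls y + 𝟙 (k ≡ᵇ y))     ≡⟨ cong (at (decAt ρ k) y +_) (+-comm (count ls y) _) ⟩
      at (decAt ρ k) y + (𝟙 (k ≡ᵇ y) + count ls y)     ≡⟨ +-assoc (at (decAt ρ k) y) _ _ ⟨
      at (decAt ρ k) y + 𝟙 (k ≡ᵇ y) + count ls y       ≡⟨ cong (_+ count ls y) (at-decAt-+δ ρ k y 1≤k 1≤ρk) ⟩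
      at ρ y + count ls y                               ≡⟨ removed y 1≤y ⟩
      at μ y                                            ∎
      where open ≡-Reasoning

    length-ls∷ʳ : ∀ k → length (ls ∷ʳ k) ≡ suc i
    length-ls∷ʳ k = trans (length-++ ls) (trans (+-comm (length ls) 1) (cong suc length-ls))

    sum-decAt : ∀ k → 1 ≤ k → k ≤ next → 1 ≤ at ρ k → sum (decAt ρ k) + suc i ≡ n
    sum-decAt k 1≤k k≤next 1≤ρk = trans (cong (sum (decAt ρ k) +_) (sym (length-ls∷ʳ k)))
      (sum-after-removal (decAt ρ k) (ls ∷ʳ k) (lastPositive-decAt ρ k) (removed-decAt k 1≤k 1≤ρk)
        (∷ʳ⁺ ls-in-range (1≤k , ≤-trans k≤next (proj₂ next-in-range))))

    sum-lam-tilde^ : sum (lam (tilde^ (suc i) a)) + suc i ≡ n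
    sum-lam-tilde^ = trans (cong (_+ suc i) (sum-lam (tilde^ (suc i) a))) (trans (Iterates.sum-tilde^ a (suc i) i<c) (proj₂ ha))

    sum-lam-tilde^≡ : ∀ k → 1 ≤ k → k ≤ next → 1 ≤ at ρ k → sum (lam (tilde^ (suc i) a)) ≡ sum (decAt ρ k)
    sum-lam-tilde^≡ k 1≤k k≤next 1≤ρk = +-cancelʳ-≡ (suc i) _ _ (trans sum-lam-tilde^ (sym (sum-decAt k 1≤k k≤next 1≤ρk)))

    psum-decAt-next : ∀ j → psum (decAt ρ next) j + ∑ j (λ y → 𝟙 (next ≡ᵇ y)) ≡ psum ρ j
    psum-decAt-next j rewrite psum≡∑ (decAt ρ next) j | psum≡∑ ρ j =
      trans (sym (∑-distrib-+ j _ _)) (∑-cong j (λ y _ _ → at-decAt-+δ ρ next y 1≤next 1≤ρ-next))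

    -- Before row next nothing changes; from row next on the bound of psum-lam-tilde^+≤ applies.
    psum-dominates-next : ∀ j → psum (lam (tilde^ (suc i) a)) j ≤ psum (decAt ρ next) j
    psum-dominates-next j with next ≤? j
    ... | no next≰j = begin
        psum (lam (tilde (tilde^ i a))) j  ≤⟨ psum-lam-tilde≤ (tilde^ i a) j ⟩
        psum (lam (tilde^ i a)) j          ≤⟨ dominates j ⟩
        psum ρ j                           ≡⟨ psum-decAt-next j ⟨
        psum (decAt ρ next) j + ∑ j (λ y → 𝟙 (next ≡ᵇ y))  ≡⟨ cong (psum (decAt ρ next) j +_) (∑-δ-out j next (≰⇒> next≰j)) ⟩
        psum (decAt ρ next) j + 0          ≡⟨ +-identityʳ _ ⟩
        psum (decAt ρ next) j              ∎
      where open ≤-Reasoning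
    ... | yes next≤j = +-cancelʳ-≤ (suc i) _ _ (begin
        psum (lam (tilde^ (suc i) a)) j + suc i  ≤⟨ psum-lam-tilde^+≤ i j i<c take-in-range ⟩
        psum μ j                           ≡⟨ psum-+∑count μ ρ ls removed j ⟨
        psum ρ j + ∑ j (count ls)          ≡⟨ cong₂ _+_ (sym (psum-decAt-next j)) ∑-count-ls ⟩
        psum (decAt ρ next) j + ∑ j (λ y → 𝟙 (next ≡ᵇ y)) + i  ≡⟨ cong (λ z → psum (decAt ρ next) j + z + i) (∑-δ j next 1≤next next≤j) ⟩
        psum (decAt ρ next) j + 1 + i      ≡⟨ +-assoc (psum (decAt ρ next) j) 1 i ⟩
        psum (decAt ρ next) j + suc i      ∎)
      where
      open ≤-Reasoning
      take-in-range : All (λ k → 1 ≤ k × k ≤ j) (take (suc i) rows)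
      take-in-range = All.map (λ (r≤k , k≤next) → ≤-trans 1≤r r≤k , ≤-trans k≤next next≤j)
                              (take-linked-bounds r rows ts-sorted (suc i) i<length-rows)
      ∑-count-ls : ∑ j (count ls) ≡ i
      ∑-count-ls = trans (∑-count j ls (All.zip (ls-positive , All.map (λ k≤ → ≤-trans k≤ next≤j) ls≤next))) length-ls

    next∈R : InR ρ (tilde^ i a) next
    next∈R = 1≤next , next≤length-ρ , corner
           , psum≤⇒dom (decAt ρ next) (lam (tilde^ (suc i) a)) (lastPositive-decAt ρ next)
               (≤-reflexive (sym (sum-lam-tilde^≡ next 1≤next ≤-refl 1≤ρ-next))) psum-dominates-next

    l′-spec : Σ ℕ (λ l′ → lmin ρ (tilde^ i a) l ≡ just l′ × InR ρ (tilde^ i a) l′ × l′ ≤ next)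
    l′-spec = lmin-≤ ρ (tilde^ i a) l next next∈R (≤-trans l≤t t≤next)

    l′ : ℕ
    l′ = proj₁ l′-spec

    l′∈R : InR ρ (tilde^ i a) l′
    l′∈R = proj₁ (proj₂ (proj₂ l′-spec))

    l′≤next : l′ ≤ next
    l′≤next = proj₂ (proj₂ (proj₂ l′-spec))

    1≤l′ : 1 ≤ l′
    1≤l′ = proj₁ l′∈R

    1≤ρl′ : 1 ≤ at ρ l′
    1≤ρl′ = ≤-trans (s≤s z≤n) (proj₁ (proj₂ (proj₂ l′∈R)))

    -- Since i < a_h ≤ every element of A, the search for l_{i+1} starts at l_i.
    sequence′ : seqAlμ a μ r (suc i) ≡ just (tilde^ (suc i) a , l′ , decAt ρ l′)
    sequence′ = seqAlμ-suc i sequence (∉Aset a i 1≤length-a i<c) (proj₁ (proj₂ l′-spec))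

    invariant′ : Invariant (suc i)
    invariant′ = record
      { ρ = decAt ρ l′ ; l = l′ ; ls = ls ∷ʳ l′
      ; sequence = sequence′
      ; removed = removed-decAt l′ 1≤l′ 1≤ρl′
      ; ls≤rows = subst (Pointwise _≤_ (ls ∷ʳ l′)) (sym take-suc-rows) (Pointwise.++⁺ ls≤rows (l′≤next ∷ []))
      ; ls-positive = ∷ʳ⁺ ls-positive 1≤l′
      ; length-ls = length-ls∷ʳ l′
      ; l≤t = l′≤next
      ; ρ-lastPositive = lastPositive-decAt ρ l′
      ; dominates = dom⇒psum≤ (decAt ρ l′) (lam (tilde^ (suc i) a))
                      (≤-reflexive (sum-lam-tilde^≡ l′ 1≤l′ l′≤next 1≤ρl′)) (proj₂ (proj₂ (proj₂ l′∈R)))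
      }

  invariant : ∀ i → i ≤ c → Invariant i
  invariant zero    _   = invariant₀
  invariant (suc i) i<c = Step.invariant′ i i<c (invariant i (<⇒≤ i<c))

  l-bound : (i : ℕ) → 1 ≤ i → i ≤ c → Σ ℕ (λ l → lSeq a μ r i ≡ just l × l ≤ at rows i)
  l-bound (suc i) _ i<c = l , lSeq-just (suc i) sequence , l≤t
    where open Invariant (invariant (suc i) i<c)

  -- μ^{(t_1,…,t_c)} and μ^c remove cells from the rows t_1 ≤ … ≤ t_c and l_1, …, l_c respectively,
  -- and l_i ≤ t_i, so every prefix of μ^c loses at least as many cells.
  final-dominance : Σ (List ℕ) (λ ν → μSeq a μ r c ≡ just ν × Dom (decAll μ rows) ν)
  final-dominance = ρ , μSeq-just c sequence , psum≤⇒dom σ ρ σ-lastPositive (≤-reflexive sum-σ≡sum-ρ) psum-ρ≤psum-σ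
    where
    open Invariant (invariant c ≤-refl)
    σ = decAll μ rows
    rows-positive : All (1 ≤_) rows
    rows-positive = All.map proj₁ rows-in-range
    removed-σ : ∀ y → 1 ≤ y → at σ y + count rows y ≡ at μ y
    removed-σ = at-decAll-+count μ rows (λ y 1≤y → ≤-trans (m≤m+n _ _) (count-rows+at-μ≤ y 1≤y)) rows-positive
    σ-lastPositive : LastPositive σ
    σ-lastPositive = lastPositive-decAll μ rows (allPositive⇒lastPositive μ μ-positive)
    ls≤rows′ : Pointwise _≤_ ls rows
    ls≤rows′ = subst (Pointwise _≤_ ls) (take-all c rows (≤-reflexive length-rows)) ls≤rows
    ls-in-range : All (λ k → 1 ≤ k × k ≤ n) ls
    ls-in-range = All.zip (ls-positive , pointwise-≤-bound ls≤rows′ (All.map proj₂ rows-in-range))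
    sum-σ≡sum-ρ : sum σ ≡ sum ρ
    sum-σ≡sum-ρ = +-cancelʳ-≡ c _ _ (trans (cong (sum σ +_) (sym length-rows))
      (trans (sum-after-removal σ rows σ-lastPositive removed-σ rows-in-range)
             (sym (trans (cong (sum ρ +_) (sym length-ls)) (sum-after-removal ρ ls ρ-lastPositive removed ls-in-range)))))
    psum-ρ≤psum-σ : ∀ j → psum ρ j ≤ psum σ j
    psum-ρ≤psum-σ j = +-cancelʳ-≤ (∑ j (count rows)) _ _ (begin
      psum ρ j + ∑ j (count rows)  ≤⟨ +-monoʳ-≤ (psum ρ j) (begin
                                        ∑ j (count rows)  ≡⟨ ∑-count≡count≤ j rows rows-positive ⟩
                                        count≤ rows j     ≤⟨ count≤-antitone j ls≤rows′ ⟩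
                                        count≤ ls j       ≡⟨ ∑-count≡count≤ j ls ls-positive ⟨
                                        ∑ j (count ls)    ∎) ⟩
      psum ρ j + ∑ j (count ls)    ≡⟨ psum-+∑count μ ρ ls removed j ⟩
      psum μ j                     ≡⟨ psum-+∑count μ σ rows removed-σ j ⟨
      psum σ j + ∑ j (count rows)  ∎)
      where open ≤-Reasoning

lemma5p5 : (n : ℕ) (μ a : List ℕ) → IsPartition n μ → IsComposition n a
    → Dom μ (lam a)
    → (r : ℕ) → InR μ a r → r ≤ s μ a
    → (T : ℕ → ℕ → ℕ) → IsSTab μ a T
    → (ts : List (ℕ × ℕ)) → length ts ≡ lastPart a
    → (∀ i j → ((i , j) ∈ ts) ⇔ (InD μ i j × T i j ≡ length a))
    → Linked _≤_ (r ∷ map proj₁ ts)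
    → ((i : ℕ) → 1 ≤ i → i ≤ lastPart a
         → Σ ℕ (λ l → lSeq a μ r i ≡ just l × l ≤ at (map proj₁ ts) i))
      × Σ (List ℕ) (λ ν → μSeq a μ r (lastPart a) ≡ just ν
                          × Dom (decAll μ (map proj₁ ts)) ν)
lemma5p5 n μ a hμ ha hD r hR _ T hT ts length-ts ts-spec ts-sorted = l-bound , final-dominance
  where open Construction n μ a hμ ha hD r hR T hT ts length-ts ts-spec ts-sorted
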